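{- For all integers $n\ge0$ and $k\ge1$, \[ (-1)^{kn}\left.R^{(k)}\!\left(\mu^{\le k}_{ -n}(\mathbf{b},\boldsymbol{\lambda})\right)\right|_{\mathbf{b}=\mathbf{b}^{(k)},\ \boldsymbol{\lambda}=-\mathbf{1}}=\left|\mathrm{Alt}^{\le k+1}_n\right|. \]
   Context: Here $b_0,b_1,\dots,\lambda_1,\lambda_2,\dots$ are indeterminates. A Motzkin path is a finite sequence of points in $\mathbb{Z}\times\mathbb{Z}_{\ge0}$ whose steps are each $(1,1)$, $(1,0)$ or $(1,-1)$; its weight is the product of $b_i$ over horizontal steps starting at height $i$ and $\lambda_i$ over down steps starting at height $i$. $\mu^{\le k}_N(\mathbf{b},\boldsymbol{\lambda})$ ($N\ge0$) is the sum of weights of Motzkin paths from $(0,0)$ to $(N,0)$ staying weakly below $y=k$. If $(f_N)_{N\ge0}$ satisfies $f_N=c_1f_{N-1}+\cdots+c_df_{N-d}$ for all $N\ge d$ with $c_d\ne0$, it is extended uniquely to all $N\in\mathbb{Z}$ so the recurrence holds for all $N$; $\mu^{\le k}_{ -N}(\mathbf{b},\boldsymbol{\lambda})$ denotes this extension, a rational function in $b_0,\dots,b_k,\lambda_1,\dots,\lambda_k$. $R^{(k)}$ replaces each $b_i$ by $b_{k-i}$ and each $\lambda_i$ by $\lambda_{k+1-i}$. Then one substitutes $b_i=b^{(k)}_i$ and $\lambda_i=-1$, where $b^{(k)}_i=2(-1)^i$ for $0\le i<k$ and $b^{(k)}_i=(-1)^i$ for $i\ge k$. $\mathrm{Alt}^{\le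 K}_n$ is the set of integer sequences $(a_1,\dots,a_n)$ with $a_1\le a_2\ge a_3\le a_4\ge\cdots$ and $1\le a_i\le K$ (for $n=0$, the empty sequence). -}

module Defs where

open import Data.Nat as ℕ using (ℕ; zero; suc; _∸_; _≤ᵇ_; _<ᵇ_)
open import Data.Integer as ℤ using (ℤ; +_; -[1+_]; _+_; _*_; -_; _-_; _^_)
open import Data.Bool using (Bool; true; false; _∧_; if_then_else_)
open import Data.List using (List; []; _∷_; map; concatMap; upTo; filterᵇ; length)
open import Data.Maybe using (Maybe; just; nothing)
import Data.Maybe as Maybe
open import Data.Product using (_×_; _,_; proj₁; proj₂; ∃)
open import Relation.Binary.PropositionalEquality using (_≡_; _≢_)

-- Polynomials with integer coefficients in the indeterminates
-- b_0, b_1, ... and λ_0, λ_1, ... (λ_0 is never used by μ).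
-- A polynomial is a syntactic expression; two expressions denote the
-- same polynomial iff they agree at every integer point (ℤ is infinite).

data Var : Set where
  bv : ℕ → Var
  lv : ℕ → Var

data Expr : Set where
  var : Var → Expr
  con : ℤ → Expr
  _⊕_ : Expr → Expr → Expr
  _⊗_ : Expr → Expr → Expr

infixl 6 _⊕_
infixl 7 _⊗_

Point : Set
Point = Var → ℤ

eval : Point → Expr → ℤ
eval x (var v) = x v
eval x (con c) = c
eval x (e ⊕ f) = eval x e + eval x f
eval x (e ⊗ f) = eval x e * eval x f

substE : (Var → Expr) → Expr → Expr
substE σ (var v) = σ v
substE σ (con c) = con c
substE σ (e ⊕ f) = substE σ e ⊕ substE σ f
substE σ (e ⊗ f) = substE σ e ⊗ substE σ f

NonZeroPoly : Expr → Set
NonZeroPoly e = ∃ λ (x : Point) → eval x e ≢ + 0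

sumE : List Expr → Expr
sumE [] = con (+ 0)
sumE (e ∷ es) = e ⊕ sumE es

RatFun : Set
RatFun = Expr × Expr

num den : RatFun → Expr
num = proj₁
den = proj₂

_≈ʳ_ : RatFun → RatFun → Set
r ≈ʳ s = (x : Point) → eval x (num r) * eval x (den s) ≡ eval x (num s) * eval x (den r)

_+ʳ_ : RatFun → RatFun → RatFun
(a , b) +ʳ (c , e) = (a ⊗ e ⊕ c ⊗ b , b ⊗ e)

_·ʳ_ : Expr → RatFun → RatFun
c ·ʳ (a , b) = (c ⊗ a , b)

0ʳ : RatFun
0ʳ = (con (+ 0) , con (+ 1))

data Step : Set where
  U H D : Step

allWords : ℕ → List (List Step)
allWords zero = [] ∷ []
allWords (suc N) = concatMap (λ s → map (s ∷_) (allWords N)) (U ∷ H ∷ D ∷ [])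

-- pathWeight k h w : weight of the path with steps w starting at height h,
-- or nothing if it leaves the strip 0 ≤ y ≤ k or does not end at height 0.
pathWeight : ℕ → ℕ → List Step → Maybe Expr
pathWeight k zero [] = just (con (+ 1))
pathWeight k (suc h) [] = nothing
pathWeight k h (U ∷ w) = if h <ᵇ k then pathWeight k (suc h) w else nothing
pathWeight k h (H ∷ w) = Maybe.map (λ e → var (bv h) ⊗ e) (pathWeight k h w)
pathWeight k zero (D ∷ w) = nothing
pathWeight k (suc h) (D ∷ w) = Maybe.map (λ e → var (lv (suc h)) ⊗ e) (pathWeight k h w)

collect : List (Maybe Expr) → List Expr
collect [] = []
collect (just e ∷ es) = e ∷ collect es
collect (nothing ∷ es) = collect es

μ : ℕ → ℕ → Expr
μ k N = sumE (collect (map (pathWeight k 0) (allWords N)))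

-- Extension of (μ^{≤k}_N)_{N≥0} to all N ∈ ℤ in the field of rational
-- functions via a linear recurrence f_N = c_1 f_{N-1} + ... + c_d f_{N-d}
-- with c_d ≠ 0 (holding for all N ∈ ℤ for the extension h).

recSum : (ℕ → Expr) → (ℤ → RatFun) → ℤ → ℕ → RatFun
recSum c h N zero = 0ʳ
recSum c h N (suc i) = recSum c h N i +ʳ (c (suc i) ·ʳ h (N - + suc i))

record RecExtension (k : ℕ) : Set where
  field
    d      : ℕ
    d≥1    : 1 ℕ.≤ d
    c      : ℕ → Expr          -- coefficients c_1 .. c_d (c_0, c_{>d} unused)
    cd≢0   : NonZeroPoly (c d)
    h      : ℤ → RatFun
    den≢0  : (N : ℤ) → NonZeroPoly (den (h N))
    agrees : (N : ℕ) → h (+ N) ≈ʳ (μ k N , con (+ 1))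
    rec    : (N : ℤ) → h N ≈ʳ recSum c h N d

-- R^{(k)}: b_i ↦ b_{k-i} (0 ≤ i ≤ k), λ_i ↦ λ_{k+1-i} (1 ≤ i ≤ k);
-- other variables are fixed (they do not occur in μ^{≤k}).

Rσ : ℕ → Var → Expr
Rσ k (bv i) = if i ≤ᵇ k then var (bv (k ∸ i)) else var (bv i)
Rσ k (lv zero) = var (lv zero)
Rσ k (lv (suc i)) = if suc i ≤ᵇ k then var (lv (suc k ∸ suc i)) else var (lv (suc i))

R : ℕ → Expr → Expr
R k = substE (Rσ k)

bk : ℕ → ℕ → ℤ
bk k i = if i <ᵇ k then + 2 * (- + 1) ^ i else (- + 1) ^ i

specPoint : ℕ → Point
specPoint k (bv i) = bk k i
specPoint k (lv i) = - + 1

specR : ℕ → Expr → ℤ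
specR k e = eval (specPoint k) (R k e)

allSeqs : ℕ → ℕ → List (List ℕ)
allSeqs K zero = [] ∷ []
allSeqs K (suc n) = concatMap (λ a → map (a ∷_) (allSeqs K n)) (map suc (upTo K))

mutual
  altUp : List ℕ → Bool
  altUp (a ∷ b ∷ s) = (a ≤ᵇ b) ∧ altDown (b ∷ s)
  altUp _ = true

  altDown : List ℕ → Bool
  altDown (a ∷ b ∷ s) = (b ≤ᵇ a) ∧ altUp (b ∷ s)
  altDown _ = true

Alt : ℕ → ℕ → List (List ℕ)
Alt K n = filterᵇ altUp (allSeqs K n)

#Alt : ℕ → ℕ → ℕ
#Alt K n = length (Alt K n)

-- The numbers uₙ(h) of weighted Motzkin paths of length n from height h down to 0 inside
-- the strip [0, k] form the orbit uₙ₊₁ = T uₙ of δ₀ under the transfer matrix T of the strip.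
-- The monic orthogonal polynomials of the weights satisfy p_j(T) δ₀ = λ₁ ⋯ λ_j δ_j, so p_{k+1}(T)
-- kills the orbit and μ^{≤k} obeys the linear recurrence with characteristic polynomial p_{k+1};
-- solving it backwards gives the extension, with denominators powers of p_{k+1}(0).
-- At the reflected point b_h = 2(-1)^{k-h} (h ≥ 1), b_0 = (-1)^k, λ = -1 one has p_{k+1}(0) = ±1,
-- so T is invertible there. The orbit continues to negative times explicitly: its state at time -r
-- is (-1)^{kr} times a vector built from the numbers of alternating sequences of length r + 1
-- over [1, k + 1] with prescribed first entry, and its entry at height 0 is (-1)^{kr} |Alt^{≤k+1}_r|.
-- Since p_{k+1}(T) commutes with T and T is injective, p_{k+1}(T) kills the whole continued orbit,
-- so its height-0 entries satisfy the recurrence as well and therefore are the extension of μ^{≤k}.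

module Submission where

open import Defs
open import Data.Nat using (ℕ; suc; _≤_)
open import Data.Integer using (ℤ; +_; -_; _*_; _^_)
open import Data.Product using (Σ; _×_)
open import Relation.Binary.PropositionalEquality using (_≡_; _≢_)

open import Data.Bool using (Bool; true; false; T; _∧_; if_then_else_)
open import Data.Bool.Properties using (T-≡; ⇔→≡)
open import Data.Empty using (⊥-elim)
open import Data.Integer using (0ℤ; 1ℤ; -1ℤ; -[1+_]; _+_; _-_; _⊖_)
import Data.Integer.Properties as ℤ
open import Data.Integer.Tactic.RingSolver using (solve-∀)
open import Data.List using (List; []; _∷_; _++_; map; concatMap; applyUpTo; filterᵇ; length)
open import Data.List.Properties using (++-identityʳ)
open import Data.Maybe using (Maybe; just; nothing)
import Data.Maybe as Maybe
open import Data.Nat as ℕ using (zero; _∸_; _<_; _≤ᵇ_; _<ᵇ_; _≡ᵇ_; z≤n; s≤s)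
import Data.Nat.Properties as ℕ
open import Data.Product using (_,_; proj₁; proj₂)
open import Data.Sum using (_⊎_; inj₁; inj₂)
open import Function using (_∘_; Equivalence; mk⇔)
open import Relation.Binary.PropositionalEquality using (refl; sym; trans; cong; cong₂; subst; module ≡-Reasoning)
open import Algebra.Properties.AbelianGroup ℤ.+-0-abelianGroup using (inverseˡ-unique)
open ≡-Reasoning

-1^n*-1^n≡1 : ∀ n → -1ℤ ^ n * -1ℤ ^ n ≡ 1ℤ
-1^n*-1^n≡1 zero    = refl
-1^n*-1^n≡1 (suc n) = trans (square-neg (-1ℤ ^ n)) (-1^n*-1^n≡1 n)
  where
  square-neg : ∀ a → (-1ℤ * a) * (-1ℤ * a) ≡ a * a
  square-neg = solve-∀

-1^[n+n]≡1 : ∀ n → -1ℤ ^ (n ℕ.+ n) ≡ 1ℤ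
-1^[n+n]≡1 n = trans (ℤ.^-distribˡ-+-* -1ℤ n n) (-1^n*-1^n≡1 n)

∸-suc : ∀ {m n} → n < m → m ∸ n ≡ suc (m ∸ suc n)
∸-suc {suc m} {zero}  _         = refl
∸-suc {suc m} {suc n} (s≤s n<m) = ∸-suc n<m

T⇒≡true : ∀ {b} → T b → b ≡ true
T⇒≡true = Equivalence.to T-≡

<ᵇ≡true⇒< : ∀ {m n} → (m <ᵇ n) ≡ true → m < n
<ᵇ≡true⇒< {m} {n} m<ᵇn = ℕ.<ᵇ⇒< m n (subst T (sym m<ᵇn) _)

<ᵇ≡false⇒≥ : ∀ {m n} → (m <ᵇ n) ≡ false → n ≤ m
<ᵇ≡false⇒≥ m≮ᵇn = ℕ.≮⇒≥ (λ m<n → subst T m≮ᵇn (ℕ.<⇒<ᵇ m<n))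

≤⇒<ᵇ≡false : ∀ {m n} → m ≤ n → (n <ᵇ m) ≡ false
≤⇒<ᵇ≡false {zero}  _         = refl
≤⇒<ᵇ≡false {suc m} (s≤s m≤n) = ≤⇒<ᵇ≡false m≤n

-1^[m∸n] : ∀ {m n} → n ≤ m → -1ℤ ^ (m ∸ n) ≡ -1ℤ ^ m * -1ℤ ^ n
-1^[m∸n] {m} {n} n≤m = begin
  -1ℤ ^ (m ∸ n)                            ≡⟨ ℤ.*-identityʳ _ ⟨
  -1ℤ ^ (m ∸ n) * 1ℤ                       ≡⟨ cong (-1ℤ ^ (m ∸ n) *_) (-1^n*-1^n≡1 n) ⟨
  -1ℤ ^ (m ∸ n) * (-1ℤ ^ n * -1ℤ ^ n)      ≡⟨ ℤ.*-assoc (-1ℤ ^ (m ∸ n)) _ _ ⟨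
  -1ℤ ^ (m ∸ n) * -1ℤ ^ n * -1ℤ ^ n        ≡⟨ cong (_* -1ℤ ^ n) (ℤ.^-distribˡ-+-* -1ℤ (m ∸ n) n) ⟨
  -1ℤ ^ (m ∸ n ℕ.+ n) * -1ℤ ^ n            ≡⟨ cong (λ e → -1ℤ ^ e * -1ℤ ^ n) (ℕ.m∸n+n≡m n≤m) ⟩
  -1ℤ ^ m * -1ℤ ^ n                        ∎

mod-square≡1 : ∀ {σ} → σ * σ ≡ 1ℤ → ∀ {a b} r → a ≡ b + (1ℤ - σ * σ) * r → a ≡ b
mod-square≡1 {σ} σ²≡1 {a} {b} r a≡b+ = begin
  a                              ≡⟨ a≡b+ ⟩
  b + (1ℤ - σ * σ) * r           ≡⟨ cong (λ t → b + (1ℤ - t) * r) σ²≡1 ⟩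
  b + (1ℤ - 1ℤ) * r              ≡⟨ ℤ.+-identityʳ b ⟩
  b                              ∎

∑< : ℕ → (ℕ → ℤ) → ℤ
∑< zero    f = 0ℤ
∑< (suc m) f = ∑< m f + f m

syntax ∑< m (λ i → e) = ∑[ i < m ] e

∑-cong : ∀ {f g : ℕ → ℤ} m → (∀ i → i < m → f i ≡ g i) → ∑< m f ≡ ∑< m g
∑-cong zero    f≡g = refl
∑-cong (suc m) f≡g = cong₂ _+_ (∑-cong m (λ i i<m → f≡g i (ℕ.m<n⇒m<1+n i<m))) (f≡g m ℕ.≤-refl)

∑-splitˡ : ∀ (f : ℕ → ℤ) m → ∑< (suc m) f ≡ f 0 + ∑< m (f ∘ suc)
∑-splitˡ f zero    = ℤ.+-comm 0ℤ (f 0)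
∑-splitˡ f (suc m) = begin
  ∑< (suc m) f + f (suc m)           ≡⟨ cong (_+ f (suc m)) (∑-splitˡ f m) ⟩
  f 0 + ∑< m (f ∘ suc) + f (suc m)   ≡⟨ ℤ.+-assoc (f 0) _ _ ⟩
  f 0 + ∑< (suc m) (f ∘ suc)         ∎

∑-reverse : ∀ (f : ℕ → ℤ) m → ∑< m f ≡ ∑[ i < m ] f (m ∸ suc i)
∑-reverse f zero    = refl
∑-reverse f (suc m) = begin
  ∑< m f + f m                             ≡⟨ cong (_+ f m) (∑-reverse f m) ⟩
  ∑[ i < m ] f (m ∸ suc i) + f m           ≡⟨ ℤ.+-comm _ (f m) ⟩
  f m + ∑[ i < m ] f (m ∸ suc i)           ≡⟨ ∑-splitˡ (λ i → f (m ∸ i)) m ⟨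
  ∑[ i < suc m ] f (suc m ∸ suc i)         ∎

∑-restrict : ∀ (f : ℕ → ℤ) {m M} → m ≤ M → ∑[ i < M ] (if i <ᵇ m then f i else 0ℤ) ≡ ∑< m f
∑-restrict f {m} {zero}  z≤n  = refl
∑-restrict f {m} {suc M} m≤1+M with ℕ.m≤n⇒m<n∨m≡n m≤1+M
... | inj₁ (s≤s m≤M) = begin
  ∑[ i < M ] (if i <ᵇ m then f i else 0ℤ) + (if M <ᵇ m then f M else 0ℤ)
    ≡⟨ cong₂ _+_ (∑-restrict f m≤M) (cong (λ b → if b then f M else 0ℤ) (≤⇒<ᵇ≡false m≤M)) ⟩
  ∑< m f + 0ℤ                                ≡⟨ ℤ.+-identityʳ _ ⟩
  ∑< m f                                      ∎
... | inj₂ refl = ∑-cong (suc M) (λ i i<m → cong (λ b → if b then f i else 0ℤ) (T⇒≡true (ℕ.<⇒<ᵇ i<m)))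

eval-substE : ∀ x σ e → eval x (substE σ e) ≡ eval (λ v → eval x (σ v)) e
eval-substE x σ (var v) = refl
eval-substE x σ (con c) = refl
eval-substE x σ (e ⊕ f) = cong₂ _+_ (eval-substE x σ e) (eval-substE x σ f)
eval-substE x σ (e ⊗ f) = cong₂ _*_ (eval-substE x σ e) (eval-substE x σ f)

_^ᴱ_ : Expr → ℕ → Expr
e ^ᴱ zero  = con 1ℤ
e ^ᴱ suc n = e ⊗ e ^ᴱ n

eval-^ᴱ : ∀ x e n → eval x (e ^ᴱ n) ≡ eval x e ^ n
eval-^ᴱ x e zero    = refl
eval-^ᴱ x e (suc n) = cong (eval x e *_) (eval-^ᴱ x e n)

-ᴱ_ : Expr → Expr
-ᴱ e = con -1ℤ ⊗ e

eval--ᴱ : ∀ x e → eval x (-ᴱ e) ≡ - eval x e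
eval--ᴱ x e = ℤ.-1*i≡-i (eval x e)

-- Path sums and the transfer operator

weightSum : Point → (List Step → Maybe Expr) → List (List Step) → ℤ
weightSum x f ws = eval x (sumE (collect (map f ws)))

weightSum-++ : ∀ x f ws vs → weightSum x f (ws ++ vs) ≡ weightSum x f ws + weightSum x f vs
weightSum-++ x f []       vs = sym (ℤ.+-identityˡ _)
weightSum-++ x f (w ∷ ws) vs with f w
... | just e  = trans (cong (_+_ (eval x e)) (weightSum-++ x f ws vs)) (sym (ℤ.+-assoc (eval x e) _ _))
... | nothing = weightSum-++ x f ws vs

weightSum-map : ∀ x f g ws → weightSum x f (map g ws) ≡ weightSum x (f ∘ g) ws
weightSum-map x f g []       = refl
weightSum-map x f g (w ∷ ws) with f (g w)
... | just e  = cong (_+_ (eval x e)) (weightSum-map x f g ws)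
... | nothing = weightSum-map x f g ws

weightSum-nothing : ∀ x ws → weightSum x (λ _ → nothing) ws ≡ 0ℤ
weightSum-nothing x []       = refl
weightSum-nothing x (w ∷ ws) = weightSum-nothing x ws

weightSum-scale : ∀ x c f ws → weightSum x (Maybe.map (c ⊗_) ∘ f) ws ≡ eval x c * weightSum x f ws
weightSum-scale x c f []       = sym (ℤ.*-zeroʳ (eval x c))
weightSum-scale x c f (w ∷ ws) with f w
... | just e  = trans (cong (_+_ (eval x c * eval x e)) (weightSum-scale x c f ws))
                      (sym (ℤ.*-distribˡ-+ (eval x c) (eval x e) _))
... | nothing = weightSum-scale x c f ws

weightSum-if : ∀ x b f ws → weightSum x (λ w → if b then f w else nothing) ws ≡ (if b then weightSum x f ws else 0ℤ)
weightSum-if x true  f ws = refl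
weightSum-if x false f ws = weightSum-nothing x ws

pathSum : Point → ℕ → ℕ → ℕ → ℤ
pathSum x k N h = weightSum x (pathWeight k h) (allWords N)

stepUp : ℕ → (ℕ → ℤ) → ℕ → ℤ
stepUp k v h = if h <ᵇ k then v (suc h) else 0ℤ

stepDown : Point → (ℕ → ℤ) → ℕ → ℤ
stepDown x v zero    = 0ℤ
stepDown x v (suc h) = x (lv (suc h)) * v h

transfer : Point → ℕ → (ℕ → ℤ) → ℕ → ℤ
transfer x k v h = stepUp k v h + (x (bv h) * v h + stepDown x v h)

δ : ℕ → ℕ → ℤ
δ h j = if h ≡ᵇ j then 1ℤ else 0ℤ

pathSum-zero : ∀ x k h → pathSum x k 0 h ≡ δ h 0
pathSum-zero x k zero    = refl
pathSum-zero x k (suc h) = refl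

pathSum-suc : ∀ x k N h → pathSum x k (suc N) h ≡ transfer x k (pathSum x k N) h
pathSum-suc x k N h = begin
  weightSum x f (map (U ∷_) ws ++ map (H ∷_) ws ++ map (D ∷_) ws ++ [])
    ≡⟨ weightSum-++ x f (map (U ∷_) ws) _ ⟩
  weightSum x f (map (U ∷_) ws) + weightSum x f (map (H ∷_) ws ++ map (D ∷_) ws ++ [])
    ≡⟨ cong (_+_ (weightSum x f (map (U ∷_) ws))) (weightSum-++ x f (map (H ∷_) ws) _) ⟩
  weightSum x f (map (U ∷_) ws) + (weightSum x f (map (H ∷_) ws) + weightSum x f (map (D ∷_) ws ++ []))
    ≡⟨ cong (λ ws′ → weightSum x f (map (U ∷_) ws) + (weightSum x f (map (H ∷_) ws) + weightSum x f ws′))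
            (++-identityʳ (map (D ∷_) ws)) ⟩
  weightSum x f (map (U ∷_) ws) + (weightSum x f (map (H ∷_) ws) + weightSum x f (map (D ∷_) ws))
    ≡⟨ cong₂ _+_ (up h) (cong₂ _+_ (level h) (down h)) ⟩
  transfer x k (pathSum x k N) h ∎
  where
  ws = allWords N
  f  = pathWeight k h
  up : ∀ h → weightSum x (pathWeight k h) (map (U ∷_) ws) ≡ stepUp k (pathSum x k N) h
  up zero    = trans (weightSum-map x (pathWeight k 0) (U ∷_) ws) (weightSum-if x (0 <ᵇ k) (pathWeight k 1) ws)
  up (suc h) = trans (weightSum-map x (pathWeight k (suc h)) (U ∷_) ws)
                     (weightSum-if x (suc h <ᵇ k) (pathWeight k (suc (suc h))) ws)
  level : ∀ h → weightSum x (pathWeight k h) (map (H ∷_) ws) ≡ x (bv h) * pathSum x k N h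
  level zero    = trans (weightSum-map x (pathWeight k 0) (H ∷_) ws) (weightSum-scale x (var (bv 0)) (pathWeight k 0) ws)
  level (suc h) = trans (weightSum-map x (pathWeight k (suc h)) (H ∷_) ws)
                        (weightSum-scale x (var (bv (suc h))) (pathWeight k (suc h)) ws)
  down : ∀ h → weightSum x (pathWeight k h) (map (D ∷_) ws) ≡ stepDown x (pathSum x k N) h
  down zero    = trans (weightSum-map x (pathWeight k 0) (D ∷_) ws) (weightSum-nothing x ws)
  down (suc h) = trans (weightSum-map x (pathWeight k (suc h)) (D ∷_) ws)
                       (weightSum-scale x (var (lv (suc h))) (pathWeight k h) ws)

stepUp-linear : ∀ k a (v w : ℕ → ℤ) h → stepUp k (λ i → a * v i + w i) h ≡ a * stepUp k v h + stepUp k w h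
stepUp-linear k a v w h with h <ᵇ k
... | true  = refl
... | false = sym (trans (cong (_+ 0ℤ) (ℤ.*-zeroʳ a)) (ℤ.+-identityʳ 0ℤ))

stepDown-linear : ∀ x a (v w : ℕ → ℤ) h → stepDown x (λ i → a * v i + w i) h ≡ a * stepDown x v h + stepDown x w h
stepDown-linear x a v w zero    = sym (trans (cong (_+ 0ℤ) (ℤ.*-zeroʳ a)) (ℤ.+-identityʳ 0ℤ))
stepDown-linear x a v w (suc h) = distrib (x (lv (suc h))) a (v h) (w h)
  where
  distrib : ∀ l a p q → l * (a * p + q) ≡ a * (l * p) + l * q
  distrib = solve-∀

transfer-linear : ∀ x k a (v w : ℕ → ℤ) h →
  transfer x k (λ i → a * v i + w i) h ≡ a * transfer x k v h + transfer x k w h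
transfer-linear x k a v w h = begin
  transfer x k (λ i → a * v i + w i) h
    ≡⟨ cong₂ (λ u d → u + (x (bv h) * (a * v h + w h) + d)) (stepUp-linear k a v w h) (stepDown-linear x a v w h) ⟩
  (a * stepUp k v h + stepUp k w h) + (x (bv h) * (a * v h + w h) + (a * stepDown x v h + stepDown x w h))
    ≡⟨ regroup a (stepUp k v h) (stepUp k w h) (x (bv h)) (v h) (w h) (stepDown x v h) (stepDown x w h) ⟩
  a * transfer x k v h + transfer x k w h ∎
  where
  regroup : ∀ a u u′ b p q d d′ →
    (a * u + u′) + (b * (a * p + q) + (a * d + d′)) ≡ a * (u + (b * p + d)) + (u′ + (b * q + d′))
  regroup = solve-∀

transfer-zero : ∀ x k h → transfer x k (λ _ → 0ℤ) h ≡ 0ℤ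
transfer-zero x k h = trans (cong₂ (λ u d → u + (x (bv h) * 0ℤ + d)) (up h) (down h)) (zero-sum (x (bv h)))
  where
  up : ∀ h → stepUp k (λ _ → 0ℤ) h ≡ 0ℤ
  up h with h <ᵇ k
  ... | true  = refl
  ... | false = refl
  down : ∀ h → stepDown x (λ _ → 0ℤ) h ≡ 0ℤ
  down zero    = refl
  down (suc h) = ℤ.*-zeroʳ (x (lv (suc h)))
  zero-sum : ∀ b → 0ℤ + (b * 0ℤ + 0ℤ) ≡ 0ℤ
  zero-sum = solve-∀

transfer-cong : ∀ x k {v w : ℕ → ℤ} → (∀ h → h ≤ k → v h ≡ w h) →
  ∀ h → h ≤ k → transfer x k v h ≡ transfer x k w h
transfer-cong x k {v} {w} v≡w h h≤k = cong₂ _+_ up (cong₂ _+_ (cong (x (bv h) *_) (v≡w h h≤k)) (down h h≤k))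
  where
  up : stepUp k v h ≡ stepUp k w h
  up with h <ᵇ k in h<ᵇk
  ... | true  = v≡w (suc h) (<ᵇ≡true⇒< h<ᵇk)
  ... | false = refl
  down : ∀ h → h ≤ k → stepDown x v h ≡ stepDown x w h
  down zero    _     = refl
  down (suc h) 1+h≤k = cong (x (lv (suc h)) *_) (v≡w h (ℕ.<⇒≤ 1+h≤k))

transfer-scale : ∀ x k a (v : ℕ → ℤ) h → h ≤ k → transfer x k (λ i → a * v i) h ≡ a * transfer x k v h
transfer-scale x k a v h h≤k = begin
  transfer x k (λ i → a * v i) h          ≡⟨ transfer-cong x k (λ i _ → sym (ℤ.+-identityʳ (a * v i))) h h≤k ⟩
  transfer x k (λ i → a * v i + 0ℤ) h     ≡⟨ transfer-linear x k a v (λ _ → 0ℤ) h ⟩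
  a * transfer x k v h + transfer x k _ h ≡⟨ cong (_+_ (a * transfer x k v h)) (transfer-zero x k h) ⟩
  a * transfer x k v h + 0ℤ               ≡⟨ ℤ.+-identityʳ _ ⟩
  a * transfer x k v h                    ∎

-- Polynomials in the shift operator, as coefficient lists (constant term first)

Poly : Set
Poly = List Expr

infixl 6 _+ᴾ_
infixr 7 _·ᴾ_

_+ᴾ_ : Poly → Poly → Poly
[]       +ᴾ q        = q
(a ∷ p)  +ᴾ []       = a ∷ p
(a ∷ p)  +ᴾ (b ∷ q)  = (a ⊕ b) ∷ (p +ᴾ q)

_·ᴾ_ : Expr → Poly → Poly
c ·ᴾ []      = []
c ·ᴾ (a ∷ p) = (c ⊗ a) ∷ (c ·ᴾ p)

orthStep : ℕ → Poly → Poly → Poly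
orthStep j p q = (con 0ℤ ∷ p) +ᴾ (-ᴱ var (bv j)) ·ᴾ p +ᴾ (-ᴱ var (lv j)) ·ᴾ q

-- (p_{j-1}, p_j) for the monic orthogonal polynomials p_{j+1} = (X - b_j) p_j - λ_j p_{j-1},
-- p_{-1} = 0, p_0 = 1; the recurrence for μ^{≤k} is read off p_{k+1}.
orthPair : ℕ → Poly × Poly
orthPair zero    = [] , con 1ℤ ∷ []
orthPair (suc j) = proj₂ (orthPair j) , orthStep j (proj₂ (orthPair j)) (proj₁ (orthPair j))

orth orthPrev : ℕ → Poly
orth     = proj₂ ∘ orthPair
orthPrev = proj₁ ∘ orthPair

polyAct : Point → Poly → (ℕ → ℤ) → ℕ → ℤ
polyAct x []      s n = 0ℤ
polyAct x (a ∷ p) s n = eval x a * s n + polyAct x p s (suc n)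

polyAct-+ᴾ : ∀ x p q s n → polyAct x (p +ᴾ q) s n ≡ polyAct x p s n + polyAct x q s n
polyAct-+ᴾ x []      q       s n = sym (ℤ.+-identityˡ _)
polyAct-+ᴾ x (a ∷ p) []      s n = sym (ℤ.+-identityʳ _)
polyAct-+ᴾ x (a ∷ p) (b ∷ q) s n = begin
  (eval x a + eval x b) * s n + polyAct x (p +ᴾ q) s (suc n)
    ≡⟨ cong (_+_ ((eval x a + eval x b) * s n)) (polyAct-+ᴾ x p q s (suc n)) ⟩
  (eval x a + eval x b) * s n + (polyAct x p s (suc n) + polyAct x q s (suc n))
    ≡⟨ regroup (eval x a) (eval x b) (s n) _ _ ⟩
  polyAct x (a ∷ p) s n + polyAct x (b ∷ q) s n ∎
  where
  regroup : ∀ a b t u v → (a + b) * t + (u + v) ≡ (a * t + u) + (b * t + v)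
  regroup = solve-∀

polyAct-·ᴾ : ∀ x c p s n → polyAct x (c ·ᴾ p) s n ≡ eval x c * polyAct x p s n
polyAct-·ᴾ x c []      s n = sym (ℤ.*-zeroʳ (eval x c))
polyAct-·ᴾ x c (a ∷ p) s n = begin
  eval x c * eval x a * s n + polyAct x (c ·ᴾ p) s (suc n)
    ≡⟨ cong (_+_ (eval x c * eval x a * s n)) (polyAct-·ᴾ x c p s (suc n)) ⟩
  eval x c * eval x a * s n + eval x c * polyAct x p s (suc n)
    ≡⟨ factor (eval x c) (eval x a) (s n) _ ⟩
  eval x c * polyAct x (a ∷ p) s n ∎
  where
  factor : ∀ c a t u → c * a * t + c * u ≡ c * (a * t + u)
  factor = solve-∀

polyAct-shift : ∀ x p (s t : ℕ → ℤ) m n → (∀ i → s (m ℕ.+ i) ≡ t (n ℕ.+ i)) → polyAct x p s m ≡ polyAct x p t n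
polyAct-shift x []      s t m n s≡t = refl
polyAct-shift x (a ∷ p) s t m n s≡t = cong₂ _+_ (cong (eval x a *_) head) (polyAct-shift x p s t (suc m) (suc n) tail)
  where
  head : s m ≡ t n
  head = trans (cong s (sym (ℕ.+-identityʳ m))) (trans (s≡t 0) (cong t (ℕ.+-identityʳ n)))
  tail : ∀ i → s (suc m ℕ.+ i) ≡ t (suc n ℕ.+ i)
  tail i = trans (cong s (sym (ℕ.+-suc m i))) (trans (s≡t (suc i)) (cong t (ℕ.+-suc n i)))

polyAct-orth-suc : ∀ x j s n → polyAct x (orth (suc j)) s n
  ≡ polyAct x (orth j) s (suc n) + (- x (bv j)) * polyAct x (orth j) s n + (- x (lv j)) * polyAct x (orthPrev j) s n
polyAct-orth-suc x j s n = begin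
  polyAct x ((con 0ℤ ∷ p) +ᴾ b·p +ᴾ l·q) s n
    ≡⟨ polyAct-+ᴾ x ((con 0ℤ ∷ p) +ᴾ b·p) l·q s n ⟩
  polyAct x ((con 0ℤ ∷ p) +ᴾ b·p) s n + polyAct x l·q s n
    ≡⟨ cong (_+ polyAct x l·q s n) (polyAct-+ᴾ x (con 0ℤ ∷ p) b·p s n) ⟩
  (0ℤ * s n + polyAct x p s (suc n)) + polyAct x b·p s n + polyAct x l·q s n
    ≡⟨ cong₂ (λ u v → u + v + polyAct x l·q s n) (ℤ.+-identityˡ (polyAct x p s (suc n))) (coefficient (bv j) p) ⟩
  polyAct x p s (suc n) + (- x (bv j)) * polyAct x p s n + polyAct x l·q s n
    ≡⟨ cong (_+_ (polyAct x p s (suc n) + (- x (bv j)) * polyAct x p s n)) (coefficient (lv j) q) ⟩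
  polyAct x p s (suc n) + (- x (bv j)) * polyAct x p s n + (- x (lv j)) * polyAct x q s n ∎
  where
  p = orth j
  q = orthPrev j
  b·p = (-ᴱ var (bv j)) ·ᴾ p
  l·q = (-ᴱ var (lv j)) ·ᴾ q
  coefficient : ∀ v r → polyAct x ((-ᴱ var v) ·ᴾ r) s n ≡ (- x v) * polyAct x r s n
  coefficient v r = trans (polyAct-·ᴾ x (-ᴱ var v) r s n) (cong (_* polyAct x r s n) (eval--ᴱ x (var v)))

coeff : Poly → ℕ → Expr
coeff []      i       = con 0ℤ
coeff (a ∷ p) zero    = a
coeff (a ∷ p) (suc i) = coeff p i

coeff-+ᴾ : ∀ x p q i → eval x (coeff (p +ᴾ q) i) ≡ eval x (coeff p i) + eval x (coeff q i)
coeff-+ᴾ x []      q       i       = sym (ℤ.+-identityˡ _)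
coeff-+ᴾ x (a ∷ p) []      zero    = sym (ℤ.+-identityʳ _)
coeff-+ᴾ x (a ∷ p) []      (suc i) = sym (ℤ.+-identityʳ _)
coeff-+ᴾ x (a ∷ p) (b ∷ q) zero    = refl
coeff-+ᴾ x (a ∷ p) (b ∷ q) (suc i) = coeff-+ᴾ x p q i

coeff-·ᴾ : ∀ x c p i → eval x (coeff (c ·ᴾ p) i) ≡ eval x c * eval x (coeff p i)
coeff-·ᴾ x c []      i       = sym (ℤ.*-zeroʳ (eval x c))
coeff-·ᴾ x c (a ∷ p) zero    = refl
coeff-·ᴾ x c (a ∷ p) (suc i) = coeff-·ᴾ x c p i

coeff-beyond : ∀ p {i} → length p ≤ i → coeff p i ≡ con 0ℤ
coeff-beyond []      _         = refl
coeff-beyond (a ∷ p) (s≤s p≤i) = coeff-beyond p p≤i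

length-+ᴾ : ∀ p q → length (p +ᴾ q) ≡ length p ℕ.⊔ length q
length-+ᴾ []      q       = refl
length-+ᴾ (a ∷ p) []      = refl
length-+ᴾ (a ∷ p) (b ∷ q) = cong suc (length-+ᴾ p q)

length-·ᴾ : ∀ c p → length (c ·ᴾ p) ≡ length p
length-·ᴾ c []      = refl
length-·ᴾ c (a ∷ p) = cong suc (length-·ᴾ c p)

length-orth : ∀ j → length (orth j) ≡ suc j × length (orthPrev j) ≡ j
length-orth zero    = refl , refl
length-orth (suc j) = length-next , proj₁ (length-orth j)
  where
  p = orth j
  q = orthPrev j
  length-next : length (orth (suc j)) ≡ suc (suc j)
  length-next = begin
    length ((con 0ℤ ∷ p) +ᴾ (-ᴱ var (bv j)) ·ᴾ p +ᴾ (-ᴱ var (lv j)) ·ᴾ q)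
      ≡⟨ length-+ᴾ ((con 0ℤ ∷ p) +ᴾ (-ᴱ var (bv j)) ·ᴾ p) _ ⟩
    length ((con 0ℤ ∷ p) +ᴾ (-ᴱ var (bv j)) ·ᴾ p) ℕ.⊔ length ((-ᴱ var (lv j)) ·ᴾ q)
      ≡⟨ cong₂ ℕ._⊔_ (length-+ᴾ (con 0ℤ ∷ p) ((-ᴱ var (bv j)) ·ᴾ p)) (length-·ᴾ _ q) ⟩
    (suc (length p) ℕ.⊔ length ((-ᴱ var (bv j)) ·ᴾ p)) ℕ.⊔ length q
      ≡⟨ cong (λ n → (suc (length p) ℕ.⊔ n) ℕ.⊔ length q) (length-·ᴾ _ p) ⟩
    (suc (length p) ℕ.⊔ length p) ℕ.⊔ length q
      ≡⟨ cong₂ (λ m n → (suc m ℕ.⊔ m) ℕ.⊔ n) (proj₁ (length-orth j)) (proj₂ (length-orth j)) ⟩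
    (suc (suc j) ℕ.⊔ suc j) ℕ.⊔ j
      ≡⟨ cong (ℕ._⊔ j) (ℕ.m≥n⇒m⊔n≡m (ℕ.n≤1+n (suc j))) ⟩
    suc (suc j) ℕ.⊔ j
      ≡⟨ ℕ.m≥n⇒m⊔n≡m (ℕ.m≤n⇒m≤1+n (ℕ.n≤1+n j)) ⟩
    suc (suc j) ∎

coeff-orth-suc : ∀ x j i → eval x (coeff (orth (suc j)) i)
  ≡ eval x (coeff (con 0ℤ ∷ orth j) i) + (- x (bv j)) * eval x (coeff (orth j) i) + (- x (lv j)) * eval x (coeff (orthPrev j) i)
coeff-orth-suc x j i = begin
  eval x (coeff ((con 0ℤ ∷ p) +ᴾ b·p +ᴾ l·q) i)
    ≡⟨ coeff-+ᴾ x ((con 0ℤ ∷ p) +ᴾ b·p) l·q i ⟩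
  eval x (coeff ((con 0ℤ ∷ p) +ᴾ b·p) i) + eval x (coeff l·q i)
    ≡⟨ cong₂ _+_ (trans (coeff-+ᴾ x (con 0ℤ ∷ p) b·p i) (cong (_+_ (eval x (coeff (con 0ℤ ∷ p) i))) (scaled (bv j) p)))
                 (scaled (lv j) q) ⟩
  eval x (coeff (con 0ℤ ∷ p) i) + (- x (bv j)) * eval x (coeff p i) + (- x (lv j)) * eval x (coeff q i) ∎
  where
  p = orth j
  q = orthPrev j
  b·p = (-ᴱ var (bv j)) ·ᴾ p
  l·q = (-ᴱ var (lv j)) ·ᴾ q
  scaled : ∀ v r → eval x (coeff ((-ᴱ var v) ·ᴾ r) i) ≡ (- x v) * eval x (coeff r i)
  scaled v r = trans (coeff-·ᴾ x (-ᴱ var v) r i) (cong (_* eval x (coeff r i)) (eval--ᴱ x (var v)))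

coeff-orth-leading : ∀ x j → eval x (coeff (orth j) j) ≡ 1ℤ
coeff-orth-leading x zero    = refl
coeff-orth-leading x (suc j) = begin
  eval x (coeff (orth (suc j)) (suc j))
    ≡⟨ coeff-orth-suc x j (suc j) ⟩
  eval x (coeff (orth j) j) + (- x (bv j)) * eval x (coeff (orth j) (suc j)) + (- x (lv j)) * eval x (coeff (orthPrev j) (suc j))
    ≡⟨ cong₂ (λ a b → eval x (coeff (orth j) j) + (- x (bv j)) * eval x a + (- x (lv j)) * eval x b)
             (coeff-beyond (orth j) (ℕ.≤-reflexive (proj₁ (length-orth j))))
             (coeff-beyond (orthPrev j) (ℕ.≤-trans (ℕ.≤-reflexive (proj₂ (length-orth j))) (ℕ.n≤1+n j))) ⟩
  eval x (coeff (orth j) j) + (- x (bv j)) * 0ℤ + (- x (lv j)) * 0ℤ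
    ≡⟨ drop-zeros (eval x (coeff (orth j) j)) (- x (bv j)) (- x (lv j)) ⟩
  eval x (coeff (orth j) j)
    ≡⟨ coeff-orth-leading x j ⟩
  1ℤ ∎
  where
  drop-zeros : ∀ a b c → a + b * 0ℤ + c * 0ℤ ≡ a
  drop-zeros = solve-∀

coeff-orth-constant : ∀ x j → eval x (coeff (orth (suc j)) 0)
  ≡ (- x (bv j)) * eval x (coeff (orth j) 0) + (- x (lv j)) * eval x (coeff (orthPrev j) 0)
coeff-orth-constant x j = trans (coeff-orth-suc x j 0)
  (cong (_+ (- x (lv j)) * eval x (coeff (orthPrev j) 0)) (ℤ.+-identityˡ ((- x (bv j)) * eval x (coeff (orth j) 0))))

polyAct≡∑ : ∀ x p s m → polyAct x p s m ≡ ∑[ i < length p ] (eval x (coeff p i) * s (m ℕ.+ i))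
polyAct≡∑ x []      s m = refl
polyAct≡∑ x (a ∷ p) s m = begin
  eval x a * s m + polyAct x p s (suc m)
    ≡⟨ cong₂ _+_ (cong (λ n → eval x a * s n) (sym (ℕ.+-identityʳ m))) (polyAct≡∑ x p s (suc m)) ⟩
  eval x a * s (m ℕ.+ 0) + ∑[ i < length p ] (eval x (coeff p i) * s (suc m ℕ.+ i))
    ≡⟨ cong (_+_ (eval x a * s (m ℕ.+ 0)))
            (∑-cong (length p) (λ i _ → cong (λ n → eval x (coeff p i) * s n) (sym (ℕ.+-suc m i)))) ⟩
  eval x a * s (m ℕ.+ 0) + ∑[ i < length p ] (eval x (coeff p i) * s (m ℕ.+ suc i))
    ≡⟨ ∑-splitˡ (λ i → eval x (coeff (a ∷ p) i) * s (m ℕ.+ i)) (length p) ⟨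
  ∑[ i < suc (length p) ] (eval x (coeff (a ∷ p) i) * s (m ℕ.+ i)) ∎

∑-neg : ∀ (f : ℕ → ℤ) m → ∑[ i < m ] (- f i) ≡ - ∑< m f
∑-neg f zero    = refl
∑-neg f (suc m) = trans (cong (_+ - f m) (∑-neg f m)) (sym (ℤ.neg-distrib-+ (∑< m f) (f m)))

recCoeff : ℕ → ℕ → Expr
recCoeff k t = -ᴱ coeff (orth (suc k)) (suc k ∸ t)

recurrenceSum : Point → ℕ → (ℕ → ℤ) → ℕ → ℤ
recurrenceSum x k s N = ∑[ t < suc k ] (eval x (recCoeff k (suc t)) * s (N ∸ suc t))

polyAct-orth≡recurrence : ∀ x k s m →
  polyAct x (orth (suc k)) s m ≡ s (m ℕ.+ suc k) - recurrenceSum x k s (m ℕ.+ suc k)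
polyAct-orth≡recurrence x k s m = begin
  polyAct x (orth (suc k)) s m
    ≡⟨ polyAct≡∑ x (orth (suc k)) s m ⟩
  ∑< (length (orth (suc k))) term
    ≡⟨ cong (λ n → ∑< n term) (proj₁ (length-orth (suc k))) ⟩
  ∑< (suc k) term + term (suc k)
    ≡⟨ cong₂ _+_ (∑-reverse term (suc k)) leading ⟩
  ∑[ t < suc k ] term (k ∸ t) + s (m ℕ.+ suc k)
    ≡⟨ cong (_+ s (m ℕ.+ suc k))
            (trans (∑-cong (suc k) reversed) (∑-neg (λ t → eval x (recCoeff k (suc t)) * s (m ℕ.+ suc k ∸ suc t)) (suc k))) ⟩
  - recurrenceSum x k s (m ℕ.+ suc k) + s (m ℕ.+ suc k)
    ≡⟨ ℤ.+-comm (- recurrenceSum x k s (m ℕ.+ suc k)) (s (m ℕ.+ suc k)) ⟩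
  s (m ℕ.+ suc k) - recurrenceSum x k s (m ℕ.+ suc k) ∎
  where
  term : ℕ → ℤ
  term i = eval x (coeff (orth (suc k)) i) * s (m ℕ.+ i)
  leading : term (suc k) ≡ s (m ℕ.+ suc k)
  leading = trans (cong (_* s (m ℕ.+ suc k)) (coeff-orth-leading x (suc k))) (ℤ.*-identityˡ _)
  reversed : ∀ t → t < suc k → term (k ∸ t) ≡ - (eval x (recCoeff k (suc t)) * s (m ℕ.+ suc k ∸ suc t))
  reversed t (s≤s t≤k) = begin
    eval x (coeff (orth (suc k)) (k ∸ t)) * s (m ℕ.+ (k ∸ t))
      ≡⟨ cong (λ n → eval x (coeff (orth (suc k)) (k ∸ t)) * s n) index ⟩
    eval x (coeff (orth (suc k)) (k ∸ t)) * s (m ℕ.+ suc k ∸ suc t)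
      ≡⟨ double-neg (eval x (coeff (orth (suc k)) (k ∸ t))) _ ⟩
    - ((- eval x (coeff (orth (suc k)) (k ∸ t))) * s (m ℕ.+ suc k ∸ suc t))
      ≡⟨ cong (λ c → - (c * s (m ℕ.+ suc k ∸ suc t))) (sym (eval--ᴱ x (coeff (orth (suc k)) (k ∸ t)))) ⟩
    - (eval x (recCoeff k (suc t)) * s (m ℕ.+ suc k ∸ suc t)) ∎
    where
    index : m ℕ.+ (k ∸ t) ≡ m ℕ.+ suc k ∸ suc t
    index = trans (sym (ℕ.+-∸-assoc m t≤k)) (cong (_∸ suc t) (sym (ℕ.+-suc m k)))
    double-neg : ∀ a b → a * b ≡ - ((- a) * b)
    double-neg = solve-∀

recurrence-if-annihilated : ∀ x k s m → polyAct x (orth (suc k)) s m ≡ 0ℤ →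
  s (m ℕ.+ suc k) ≡ recurrenceSum x k s (m ℕ.+ suc k)
recurrence-if-annihilated x k s m p[s]≡0 =
  trans (inverseˡ-unique _ _ (trans (sym (polyAct-orth≡recurrence x k s m)) p[s]≡0)) (ℤ.neg-involutive _)

-- Annihilation of the orbit of δ₀ by p_{k+1}(T)

IsOrbit : Point → ℕ → (ℕ → ℕ → ℤ) → Set
IsOrbit x k u = ∀ n h → h ≤ k → u (suc n) h ≡ transfer x k (u n) h

-- (p(T) uₙ)(h) for an orbit u
polyOrbit : Point → Poly → (ℕ → ℕ → ℤ) → ℕ → ℕ → ℤ
polyOrbit x p u n h = polyAct x p (λ m → u m h) n

polyOrbit-isOrbit : ∀ x k p u → IsOrbit x k u → IsOrbit x k (polyOrbit x p u)
polyOrbit-isOrbit x k []      u orbit n h h≤k = sym (transfer-zero x k h)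
polyOrbit-isOrbit x k (a ∷ p) u orbit n h h≤k = begin
  eval x a * u (suc n) h + polyOrbit x p u (suc (suc n)) h
    ≡⟨ cong₂ (λ v w → eval x a * v + w) (orbit n h h≤k) (polyOrbit-isOrbit x k p u orbit (suc n) h h≤k) ⟩
  eval x a * transfer x k (u n) h + transfer x k (polyOrbit x p u (suc n)) h
    ≡⟨ transfer-linear x k (eval x a) (u n) (polyOrbit x p u (suc n)) h ⟨
  transfer x k (polyOrbit x (a ∷ p) u n) h ∎

δ-weight : ∀ (f : ℕ → ℤ) h j → f h * δ h j ≡ f j * δ h j
δ-weight f h j with h ≡ᵇ j in h≡ᵇj
... | true  = cong (λ i → f i * 1ℤ) (ℕ.≡ᵇ⇒≡ h j (subst T (sym h≡ᵇj) _))
... | false = trans (ℤ.*-zeroʳ (f h)) (sym (ℤ.*-zeroʳ (f j)))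

δ-weight-* : ∀ (f : ℕ → ℤ) c h j → f h * (c * δ h j) ≡ f j * (c * δ h j)
δ-weight-* f c h j = begin
  f h * (c * δ h j)   ≡⟨ swap (f h) c (δ h j) ⟩
  c * (f h * δ h j)   ≡⟨ cong (c *_) (δ-weight f h j) ⟩
  c * (f j * δ h j)   ≡⟨ swap (f j) c (δ h j) ⟨
  f j * (c * δ h j)   ∎
  where
  swap : ∀ a b c → a * (b * c) ≡ b * (a * c)
  swap = solve-∀

δ-above : ∀ {h j} → j < h → δ h j ≡ 0ℤ
δ-above {suc h} {zero}  _         = refl
δ-above {suc h} {suc j} (s≤s j<h) = δ-above j<h

δ-below : ∀ {h j} → h < j → δ h j ≡ 0ℤ
δ-below {zero}  {suc j} _         = refl
δ-below {suc h} {suc j} (s≤s h<j) = δ-below h<j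

Λ : Point → ℕ → ℤ
Λ x zero    = 1ℤ
Λ x (suc j) = x (lv (suc j)) * Λ x j

orthImage : Point → ℕ → ℕ → ℤ
orthImage x j h = Λ x j * δ h j

orthPrevImage : Point → ℕ → ℕ → ℤ
orthPrevImage x zero    h = 0ℤ
orthPrevImage x (suc j) h = orthImage x j h

stepUp-orthImage : ∀ x k {j h} → j ≤ k → h ≤ k → stepUp k (orthImage x j) h ≡ orthImage x j (suc h)
stepUp-orthImage x k {j} {h} j≤k h≤k with h <ᵇ k in h<ᵇk
... | true  = refl
... | false = sym (trans (cong (Λ x j *_) (δ-above (s≤s (ℕ.≤-trans j≤k (<ᵇ≡false⇒≥ h<ᵇk))))) (ℤ.*-zeroʳ (Λ x j)))

stepDown-orthImage : ∀ x j h → stepDown x (orthImage x j) h ≡ orthImage x (suc j) h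
stepDown-orthImage x j zero    = sym (ℤ.*-zeroʳ (Λ x (suc j)))
stepDown-orthImage x j (suc h) =
  trans (δ-weight-* (λ i → x (lv (suc i))) (Λ x j) h j) (sym (ℤ.*-assoc (x (lv (suc j))) (Λ x j) (δ h j)))

orthImage-suc : ∀ x j h → orthImage x j (suc h) ≡ x (lv j) * orthPrevImage x j h
orthImage-suc x zero    h = sym (ℤ.*-zeroʳ (x (lv 0)))
orthImage-suc x (suc j) h = ℤ.*-assoc (x (lv (suc j))) (Λ x j) (δ h j)

orthImage-step : ∀ x k {j h} → j ≤ k → h ≤ k →
  transfer x k (orthImage x j) h + (- x (bv j)) * orthImage x j h + (- x (lv j)) * orthPrevImage x j h ≡ orthImage x (suc j) h
orthImage-step x k {j} {h} j≤k h≤k = begin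
  stepUp k I h + (x (bv h) * I h + stepDown x I h) + (- x (bv j)) * I h + (- x (lv j)) * orthPrevImage x j h
    ≡⟨ cong₂ (λ u v → u + v + (- x (bv j)) * I h + (- x (lv j)) * orthPrevImage x j h)
             (trans (stepUp-orthImage x k j≤k h≤k) (orthImage-suc x j h))
             (cong₂ _+_ (δ-weight-* (λ i → x (bv i)) (Λ x j) h j) (stepDown-orthImage x j h)) ⟩
  x (lv j) * orthPrevImage x j h + (x (bv j) * I h + orthImage x (suc j) h) + (- x (bv j)) * I h + (- x (lv j)) * orthPrevImage x j h
    ≡⟨ cancel (x (lv j)) (orthPrevImage x j h) (x (bv j)) (I h) (orthImage x (suc j) h) ⟩
  orthImage x (suc j) h ∎
  where
  I = orthImage x j
  cancel : ∀ l P b i n → l * P + (b * i + n) + (- b) * i + (- l) * P ≡ n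
  cancel = solve-∀

module _ (x : Point) (k : ℕ) (u : ℕ → ℕ → ℤ) (orbit : IsOrbit x k u) (start : ∀ h → h ≤ k → u 0 h ≡ δ h 0) where

  orth-start : ∀ j → j ≤ suc k →
    (∀ h → h ≤ k → polyOrbit x (orth j) u 0 h ≡ orthImage x j h) ×
    (∀ h → h ≤ k → polyOrbit x (orthPrev j) u 0 h ≡ orthPrevImage x j h)
  orth-start zero    _           = (λ h h≤k → trans (ℤ.+-identityʳ _) (cong (1ℤ *_) (start h h≤k))) , (λ _ _ → refl)
  orth-start (suc j) (s≤s j≤k) = next , proj₁ previous
    where
    previous = orth-start j (ℕ.m≤n⇒m≤1+n j≤k)
    next : ∀ h → h ≤ k → polyOrbit x (orth (suc j)) u 0 h ≡ orthImage x (suc j) h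
    next h h≤k = begin
      polyOrbit x (orth (suc j)) u 0 h
        ≡⟨ polyAct-orth-suc x j (λ m → u m h) 0 ⟩
      polyOrbit x (orth j) u 1 h + (- x (bv j)) * polyOrbit x (orth j) u 0 h + (- x (lv j)) * polyOrbit x (orthPrev j) u 0 h
        ≡⟨ cong₂ (λ v w → v + (- x (bv j)) * w + (- x (lv j)) * polyOrbit x (orthPrev j) u 0 h)
                 (trans (polyOrbit-isOrbit x k (orth j) u orbit 0 h h≤k) (transfer-cong x k (proj₁ previous) h h≤k))
                 (proj₁ previous h h≤k) ⟩
      transfer x k (orthImage x j) h + (- x (bv j)) * orthImage x j h + (- x (lv j)) * polyOrbit x (orthPrev j) u 0 h
        ≡⟨ cong (λ w → transfer x k (orthImage x j) h + (- x (bv j)) * orthImage x j h + (- x (lv j)) * w)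
                (proj₂ previous h h≤k) ⟩
      transfer x k (orthImage x j) h + (- x (bv j)) * orthImage x j h + (- x (lv j)) * orthPrevImage x j h
        ≡⟨ orthImage-step x k j≤k h≤k ⟩
      orthImage x (suc j) h ∎

  orth-annihilates : ∀ n h → h ≤ k → polyOrbit x (orth (suc k)) u n h ≡ 0ℤ
  orth-annihilates zero    h h≤k = trans (proj₁ (orth-start (suc k) ℕ.≤-refl) h h≤k)
                                         (trans (cong (Λ x (suc k) *_) (δ-below (s≤s h≤k))) (ℤ.*-zeroʳ (Λ x (suc k))))
  orth-annihilates (suc n) h h≤k = begin
    polyOrbit x (orth (suc k)) u (suc n) h       ≡⟨ polyOrbit-isOrbit x k (orth (suc k)) u orbit n h h≤k ⟩
    transfer x k (polyOrbit x (orth (suc k)) u n) h ≡⟨ transfer-cong x k (orth-annihilates n) h h≤k ⟩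
    transfer x k (λ _ → 0ℤ) h                     ≡⟨ transfer-zero x k h ⟩
    0ℤ                                            ∎

μ-recurrence : ∀ x k n → eval x (μ k (n ℕ.+ suc k)) ≡ recurrenceSum x k (λ N → eval x (μ k N)) (n ℕ.+ suc k)
μ-recurrence x k n = recurrence-if-annihilated x k (λ N → pathSum x k N 0) n
  (orth-annihilates x k (pathSum x k) (λ N h _ → pathSum-suc x k N h) (λ h _ → pathSum-zero x k h) n 0 z≤n)

-- The extension to negative indices

depth : ℤ → ℕ
depth (+ n)    = 0
depth -[1+ m ] = suc m

depth-⊖ : ∀ m n → depth (m ⊖ n) ≡ n ∸ m
depth-⊖ m n with ℕ.≤-<-connex n m
... | inj₁ n≤m = trans (cong depth (ℤ.⊖-≥ n≤m)) (sym (ℕ.m≤n⇒m∸n≡0 n≤m))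
... | inj₂ m<n = trans (cong depth (ℤ.⊖-< m<n)) (depth-neg (n ∸ m))
  where
  depth-neg : ∀ r → depth (- + r) ≡ r
  depth-neg zero    = refl
  depth-neg (suc r) = refl

[m⊖n]-t≡m⊖[n+t] : ∀ m n t → m ⊖ n - + t ≡ m ⊖ (n ℕ.+ t)
[m⊖n]-t≡m⊖[n+t] m n zero    = trans (ℤ.+-identityʳ (m ⊖ n)) (cong (m ⊖_) (sym (ℕ.+-identityʳ n)))
[m⊖n]-t≡m⊖[n+t] m n (suc t) = trans (ℤ.distribˡ-⊖-+-neg t m n) (cong (m ⊖_) (sym (ℕ.+-suc n t)))

k⊖[m+1+k]≡-[1+m] : ∀ k m → k ⊖ (m ℕ.+ suc k) ≡ -[1+ m ]
k⊖[m+1+k]≡-[1+m] k m = trans (ℤ.⊖-< (ℕ.m≤n+m (suc k) m))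
                     (cong (λ n → - + n) (trans (cong (_∸ k) (ℕ.+-suc m k)) (ℕ.m+n∸n≡m (suc m) k)))

[+m]-[+n]≡+[m∸n] : ∀ {m n} → n ≤ m → + m - + n ≡ + (m ∸ n)
[+m]-[+n]≡+[m∸n] {m} {n} n≤m = trans (ℤ.m-n≡m⊖n m n) (ℤ.⊖-≥ n≤m)

module Extension (k : ℕ) where

  lastCoeff : Expr
  lastCoeff = recCoeff k (suc k)

  -- window m j is lastCoeff^(m - depth) times the numerator at index k - m - j (see window-value);
  -- backStep m solves the recurrence at index k - m for the term at index -(m + 1).
  mutual
    window : ℕ → ℕ → Expr
    window zero    j = μ k (k ∸ j)
    window (suc m) j = if j <ᵇ k then lastCoeff ⊗ window m (suc j) else backStep m

    backStep : ℕ → Expr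
    backStep m = window m 0 ⊕ -ᴱ windowSum m k

    windowSum : ℕ → ℕ → Expr
    windowSum m zero    = con 0ℤ
    windowSum m (suc i) = windowSum m i ⊕ recCoeff k (suc i) ⊗ window m (suc i)

  numerator : ℤ → Expr
  numerator (+ n)    = μ k n
  numerator -[1+ m ] = backStep m

  extension : ℤ → RatFun
  extension N = numerator N , lastCoeff ^ᴱ depth N

  window-top : ∀ m → window (suc m) k ≡ backStep m
  window-top m rewrite ≤⇒<ᵇ≡false (ℕ.≤-refl {k}) = refl

  depth-window : ∀ m {j} → j ≤ k → depth (k ⊖ (m ℕ.+ j)) ≤ m
  depth-window m {j} j≤k = subst (_≤ m) (sym (depth-⊖ k (m ℕ.+ j)))
    (ℕ.≤-trans (ℕ.∸-monoʳ-≤ (m ℕ.+ j) j≤k) (ℕ.≤-reflexive (ℕ.m+n∸n≡m m j)))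

  module AtPoint (x : Point) where

    γ : ℤ
    γ = eval x lastCoeff

    value : ℤ → ℤ
    value N = eval x (numerator N)

    -- value N over the common denominator γ^E
    scaled : ℕ → ℤ → ℤ
    scaled E N = γ ^ (E ∸ depth N) * value N

    scaled-suc : ∀ {E} N → depth N ≤ E → scaled (suc E) N ≡ γ * scaled E N
    scaled-suc {E} N d≤E = trans (cong (λ e → γ ^ e * value N) (ℕ.+-∸-assoc 1 d≤E)) (ℤ.*-assoc γ _ (value N))

    scaled-lift : ∀ a {E} N → depth N ≤ E → scaled (a ℕ.+ E) N ≡ γ ^ a * scaled E N
    scaled-lift zero    N d≤E = sym (ℤ.*-identityˡ _)
    scaled-lift (suc a) N d≤E = begin
      scaled (suc a ℕ.+ _) N       ≡⟨ scaled-suc N (ℕ.≤-trans d≤E (ℕ.m≤n+m _ a)) ⟩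
      γ * scaled (a ℕ.+ _) N       ≡⟨ cong (γ *_) (scaled-lift a N d≤E) ⟩
      γ * (γ ^ a * scaled _ N)     ≡⟨ ℤ.*-assoc γ (γ ^ a) _ ⟨
      γ ^ suc a * scaled _ N       ∎

    window-value : ∀ m j → j ≤ k → eval x (window m j) ≡ scaled m (k ⊖ (m ℕ.+ j))
    window-value zero j j≤k = begin
      eval x (μ k (k ∸ j))                    ≡⟨ ℤ.*-identityˡ _ ⟨
      scaled 0 (+ (k ∸ j))                    ≡⟨ cong (scaled 0) (ℤ.⊖-≥ j≤k) ⟨
      scaled 0 (k ⊖ j)                        ∎
    window-value (suc m) j j≤k with j <ᵇ k in j<ᵇk
    ... | true = begin
      γ * eval x (window m (suc j))           ≡⟨ cong (γ *_) (window-value m (suc j) j<k) ⟩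
      γ * scaled m (k ⊖ (m ℕ.+ suc j))        ≡⟨ scaled-suc (k ⊖ (m ℕ.+ suc j)) (depth-window m j<k) ⟨
      scaled (suc m) (k ⊖ (m ℕ.+ suc j))      ≡⟨ cong (λ n → scaled (suc m) (k ⊖ n)) (ℕ.+-suc m j) ⟩
      scaled (suc m) (k ⊖ (suc m ℕ.+ j))      ∎
      where
      j<k = <ᵇ≡true⇒< j<ᵇk
    ... | false with ℕ.≤-antisym j≤k (<ᵇ≡false⇒≥ j<ᵇk)
    ... | refl = begin
      value -[1+ m ]                          ≡⟨ ℤ.*-identityˡ _ ⟨
      1ℤ * value -[1+ m ]                     ≡⟨ cong (λ e → γ ^ e * value -[1+ m ]) (ℕ.n∸n≡0 m) ⟨
      scaled (suc m) -[1+ m ]                 ≡⟨ cong (scaled (suc m)) (k⊖[m+1+k]≡-[1+m] k m) ⟨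
      scaled (suc m) (k ⊖ (m ℕ.+ suc k))      ≡⟨ cong (λ n → scaled (suc m) (k ⊖ n)) (ℕ.+-suc m k) ⟩
      scaled (suc m) (k ⊖ (suc m ℕ.+ k))      ∎

    depthSum : ℤ → ℕ → ℕ
    depthSum N zero    = 0
    depthSum N (suc i) = depthSum N i ℕ.+ depth (N - + suc i)

    homSum : ℤ → ℕ → ℕ → ℤ
    homSum N i E = ∑[ t < i ] (eval x (recCoeff k (suc t)) * scaled E (N - + suc t))

    DepthsBelow : ℤ → ℕ → ℕ → Set
    DepthsBelow N i E = ∀ t → t < i → depth (N - + suc t) ≤ E

    depths-below-depthSum : ∀ N i → DepthsBelow N i (depthSum N i)
    depths-below-depthSum N (suc i) t t<1+i with ℕ.m≤n⇒m<n∨m≡n t<1+i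
    ... | inj₁ (s≤s t<i) = ℕ.≤-trans (depths-below-depthSum N i t t<i) (ℕ.m≤m+n (depthSum N i) _)
    ... | inj₂ refl      = ℕ.m≤n+m _ (depthSum N i)

    homSum-lift : ∀ a N i {E} → DepthsBelow N i E → homSum N i (a ℕ.+ E) ≡ γ ^ a * homSum N i E
    homSum-lift a N zero    _  = sym (ℤ.*-zeroʳ (γ ^ a))
    homSum-lift a N (suc i) ds = begin
      homSum N i (a ℕ.+ _) + c * scaled (a ℕ.+ _) (N - + suc i)
        ≡⟨ cong₂ (λ u v → u + c * v) (homSum-lift a N i (λ t t<i → ds t (ℕ.m<n⇒m<1+n t<i)))
                                     (scaled-lift a (N - + suc i) (ds i ℕ.≤-refl)) ⟩
      γ ^ a * homSum N i _ + c * (γ ^ a * scaled _ (N - + suc i))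
        ≡⟨ factor (γ ^ a) (homSum N i _) c _ ⟩
      γ ^ a * homSum N (suc i) _ ∎
      where
      c = eval x (recCoeff k (suc i))
      factor : ∀ p r c s → p * r + c * (p * s) ≡ p * (r + c * s)
      factor = solve-∀

    recSum-value : ∀ N i → eval x (den (recSum (recCoeff k) extension N i)) ≡ γ ^ depthSum N i
                         × eval x (num (recSum (recCoeff k) extension N i)) ≡ homSum N i (depthSum N i)
    recSum-value N zero    = refl , refl
    recSum-value N (suc i) = denominator , numerator′
      where
      previous = recSum-value N i
      N′ = N - + suc i
      e  = depth N′
      d  = depthSum N i
      c  = eval x (recCoeff k (suc i))
      rs = recSum (recCoeff k) extension N i
      denominator : eval x (den rs) * eval x (lastCoeff ^ᴱ e) ≡ γ ^ (d ℕ.+ e)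
      denominator = trans (cong₂ _*_ (proj₁ previous) (eval-^ᴱ x lastCoeff e)) (sym (ℤ.^-distribˡ-+-* γ d e))
      numerator′ : eval x (num rs) * eval x (lastCoeff ^ᴱ e) + c * value N′ * eval x (den rs)
                 ≡ homSum N i (d ℕ.+ e) + c * scaled (d ℕ.+ e) N′
      numerator′ = begin
        eval x (num rs) * eval x (lastCoeff ^ᴱ e) + c * value N′ * eval x (den rs)
          ≡⟨ cong₂ (λ u v → u * eval x (lastCoeff ^ᴱ e) + c * value N′ * v) (proj₂ previous) (proj₁ previous) ⟩
        homSum N i d * eval x (lastCoeff ^ᴱ e) + c * value N′ * γ ^ d
          ≡⟨ cong (λ u → homSum N i d * u + c * value N′ * γ ^ d) (eval-^ᴱ x lastCoeff e) ⟩
        homSum N i d * γ ^ e + c * value N′ * γ ^ d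
          ≡⟨ rearrange (homSum N i d) (γ ^ e) c (value N′) (γ ^ d) ⟩
        γ ^ e * homSum N i d + c * (γ ^ d * value N′)
          ≡⟨ cong₂ (λ u n → u + c * (γ ^ n * value N′))
                   (sym (homSum-lift e N i (depths-below-depthSum N i))) (sym (ℕ.m+n∸n≡m d e)) ⟩
        homSum N i (e ℕ.+ d) + c * scaled (d ℕ.+ e) N′
          ≡⟨ cong (λ E → homSum N i E + c * scaled (d ℕ.+ e) N′) (ℕ.+-comm e d) ⟩
        homSum N i (d ℕ.+ e) + c * scaled (d ℕ.+ e) N′ ∎
        where
        rearrange : ∀ r p c n q → r * p + c * n * q ≡ p * r + c * (q * n)
        rearrange = solve-∀

    -- the recurrence at N, cleared of denominators by γ^E
    HomRec : ℕ → ℤ → Set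
    HomRec E N = scaled E N ≡ homSum N (suc k) E

    homRec-lift : ∀ {E₀ E} N → depth N ≤ E₀ → DepthsBelow N (suc k) E₀ → E₀ ≤ E → HomRec E₀ N → HomRec E N
    homRec-lift {E₀} {E} N d≤E₀ ds≤E₀ E₀≤E rec = begin
      scaled E N                           ≡⟨ cong (λ e → scaled e N) (ℕ.m∸n+n≡m E₀≤E) ⟨
      scaled (E ∸ E₀ ℕ.+ E₀) N             ≡⟨ scaled-lift (E ∸ E₀) N d≤E₀ ⟩
      γ ^ (E ∸ E₀) * scaled E₀ N           ≡⟨ cong (γ ^ (E ∸ E₀) *_) rec ⟩
      γ ^ (E ∸ E₀) * homSum N (suc k) E₀   ≡⟨ homSum-lift (E ∸ E₀) N (suc k) ds≤E₀ ⟨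
      homSum N (suc k) (E ∸ E₀ ℕ.+ E₀)     ≡⟨ cong (homSum N (suc k)) (ℕ.m∸n+n≡m E₀≤E) ⟩
      homSum N (suc k) E                   ∎

    rec-from-homRec : ∀ N → HomRec (depthSum N (suc k) ℕ.+ depth N) N →
      eval x (num (extension N)) * eval x (den (recSum (recCoeff k) extension N (suc k)))
        ≡ eval x (num (recSum (recCoeff k) extension N (suc k))) * eval x (den (extension N))
    rec-from-homRec N rec = begin
      value N * eval x (den rs)             ≡⟨ cong (value N *_) (proj₁ rs-value) ⟩
      value N * γ ^ d                       ≡⟨ ℤ.*-comm (value N) (γ ^ d) ⟩
      γ ^ d * value N                       ≡⟨ cong (λ n → γ ^ n * value N) (ℕ.m+n∸n≡m d e) ⟨
      scaled (d ℕ.+ e) N                    ≡⟨ rec ⟩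
      homSum N (suc k) (d ℕ.+ e)            ≡⟨ cong (homSum N (suc k)) (ℕ.+-comm d e) ⟩
      homSum N (suc k) (e ℕ.+ d)            ≡⟨ homSum-lift e N (suc k) (depths-below-depthSum N (suc k)) ⟩
      γ ^ e * homSum N (suc k) d            ≡⟨ ℤ.*-comm (γ ^ e) _ ⟩
      homSum N (suc k) d * γ ^ e            ≡⟨ cong₂ _*_ (proj₂ rs-value) (eval-^ᴱ x lastCoeff e) ⟨
      eval x (num rs) * eval x (den (extension N)) ∎
      where
      rs = recSum (recCoeff k) extension N (suc k)
      rs-value = recSum-value N (suc k)
      d = depthSum N (suc k)
      e = depth N

    homRec-positive : ∀ {z} → suc k ≤ z → HomRec 0 (+ z)
    homRec-positive {z} k<z = begin
      1ℤ * eval x (μ k z)                                     ≡⟨ ℤ.*-identityˡ _ ⟩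
      eval x (μ k z)                                          ≡⟨ cong (eval x ∘ μ k) (ℕ.m∸n+n≡m k<z) ⟨
      eval x (μ k (z ∸ suc k ℕ.+ suc k))                      ≡⟨ μ-recurrence x k (z ∸ suc k) ⟩
      recurrenceSum x k (eval x ∘ μ k) (z ∸ suc k ℕ.+ suc k)  ≡⟨ cong (recurrenceSum x k (eval x ∘ μ k)) (ℕ.m∸n+n≡m k<z) ⟩
      recurrenceSum x k (eval x ∘ μ k) z                      ≡⟨ ∑-cong (suc k) term ⟩
      homSum (+ z) (suc k) 0                                  ∎
      where
      term : ∀ t → t < suc k → eval x (recCoeff k (suc t)) * eval x (μ k (z ∸ suc t))
                             ≡ eval x (recCoeff k (suc t)) * scaled 0 (+ z - + suc t)
      term t t<1+k = cong (eval x (recCoeff k (suc t)) *_)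
        (trans (sym (ℤ.*-identityˡ _)) (cong (scaled 0) (sym ([+m]-[+n]≡+[m∸n] (ℕ.≤-trans t<1+k k<z)))))

    scaled-window : ∀ m {j} → j ≤ k → scaled (suc m) (k ⊖ (m ℕ.+ j)) ≡ γ * eval x (window m j)
    scaled-window m {j} j≤k =
      trans (scaled-suc (k ⊖ (m ℕ.+ j)) (depth-window m j≤k)) (cong (γ *_) (sym (window-value m j j≤k)))

    homSum-window : ∀ m {i} → i ≤ k → homSum (k ⊖ m) i (suc m) ≡ γ * eval x (windowSum m i)
    homSum-window m {zero}  _   = sym (ℤ.*-zeroʳ γ)
    homSum-window m {suc i} i<k = begin
      homSum (k ⊖ m) i (suc m) + c * scaled (suc m) (k ⊖ m - + suc i)
        ≡⟨ cong₂ (λ u v → u + c * v) (homSum-window m (ℕ.<⇒≤ i<k))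
                 (trans (cong (scaled (suc m)) ([m⊖n]-t≡m⊖[n+t] k m (suc i))) (scaled-window m i<k)) ⟩
      γ * eval x (windowSum m i) + c * (γ * eval x (window m (suc i)))
        ≡⟨ factor γ (eval x (windowSum m i)) c (eval x (window m (suc i))) ⟩
      γ * eval x (windowSum m (suc i)) ∎
      where
      c = eval x (recCoeff k (suc i))
      factor : ∀ g s c w → g * s + c * (g * w) ≡ g * (s + c * w)
      factor = solve-∀

    homRec-window : ∀ m → HomRec (suc m) (k ⊖ m)
    homRec-window m = begin
      scaled (suc m) (k ⊖ m)                    ≡⟨ cong (λ n → scaled (suc m) (k ⊖ n)) (ℕ.+-identityʳ m) ⟨
      scaled (suc m) (k ⊖ (m ℕ.+ 0))            ≡⟨ scaled-window m z≤n ⟩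
      γ * w                                     ≡⟨ split γ w s ⟩
      γ * s + γ * (1ℤ * (w + - s))              ≡⟨ cong₂ (λ u v → u + γ * v) (sym (homSum-window m ℕ.≤-refl)) last ⟩
      homSum (k ⊖ m) (suc k) (suc m)            ∎
      where
      w = eval x (window m 0)
      s = eval x (windowSum m k)
      split : ∀ g w s → g * w ≡ g * s + g * (1ℤ * (w + - s))
      split = solve-∀
      last : 1ℤ * (w + - s) ≡ scaled (suc m) (k ⊖ m - + suc k)
      last = begin
        1ℤ * (w + - s)                         ≡⟨ cong (λ v → 1ℤ * (w + v)) (eval--ᴱ x (windowSum m k)) ⟨
        1ℤ * value -[1+ m ]                    ≡⟨ cong (λ e → γ ^ e * value -[1+ m ]) (ℕ.n∸n≡0 m) ⟨
        scaled (suc m) -[1+ m ]                ≡⟨ cong (scaled (suc m)) (trans ([m⊖n]-t≡m⊖[n+t] k m (suc k)) (k⊖[m+1+k]≡-[1+m] k m)) ⟨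
        scaled (suc m) (k ⊖ m - + suc k)       ∎

    homRec-window-lifted : ∀ m → HomRec (depthSum (k ⊖ m) (suc k) ℕ.+ depth (k ⊖ m)) (k ⊖ m)
    homRec-window-lifted m = homRec-lift (k ⊖ m) depth≤ depths≤ 1+m≤ (homRec-window m)
      where
      depth≤ : depth (k ⊖ m) ≤ suc m
      depth≤ = subst (_≤ suc m) (sym (depth-⊖ k m)) (ℕ.≤-trans (ℕ.m∸n≤m m k) (ℕ.n≤1+n m))
      depths≤ : DepthsBelow (k ⊖ m) (suc k) (suc m)
      depths≤ t t<1+k = subst (_≤ suc m) (sym (trans (cong depth ([m⊖n]-t≡m⊖[n+t] k m (suc t))) (depth-⊖ k (m ℕ.+ suc t))))
        (ℕ.≤-trans (ℕ.∸-monoˡ-≤ k (ℕ.+-monoʳ-≤ m t<1+k))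
                   (ℕ.≤-reflexive (trans (cong (_∸ k) (ℕ.+-suc m k)) (ℕ.m+n∸n≡m (suc m) k))))
      1+m≤ : suc m ≤ depthSum (k ⊖ m) (suc k) ℕ.+ depth (k ⊖ m)
      1+m≤ = ℕ.≤-trans (ℕ.≤-reflexive (sym (cong depth (trans ([m⊖n]-t≡m⊖[n+t] k m (suc k)) (k⊖[m+1+k]≡-[1+m] k m)))))
                       (ℕ.≤-trans (depths-below-depthSum (k ⊖ m) (suc k) k ℕ.≤-refl) (ℕ.m≤m+n _ _))

    homRec : ∀ N → HomRec (depthSum N (suc k) ℕ.+ depth N) N
    homRec (+ z) with ℕ.≤-<-connex (suc k) z
    ... | inj₁ k<z = homRec-lift (+ z) z≤n depths≤ z≤n (homRec-positive k<z)
      where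
      depths≤ : DepthsBelow (+ z) (suc k) 0
      depths≤ t t<1+k = ℕ.≤-reflexive (cong depth ([+m]-[+n]≡+[m∸n] (ℕ.≤-trans t<1+k k<z)))
    ... | inj₂ (s≤s z≤k) = subst (λ N → HomRec (depthSum N (suc k) ℕ.+ depth N) N) k⊖[k∸z]≡z
                                 (homRec-window-lifted (k ∸ z))
      where
      k⊖[k∸z]≡z : k ⊖ (k ∸ z) ≡ + z
      k⊖[k∸z]≡z = trans (ℤ.⊖-≥ (ℕ.m∸n≤m k z)) (cong +_ (ℕ.m∸[m∸n]≡n z≤k))
    homRec -[1+ m ] = subst (λ N → HomRec (depthSum N (suc k) ℕ.+ depth N) N) (k⊖[m+1+k]≡-[1+m] k m)
                            (homRec-window-lifted (m ℕ.+ suc k))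

  recExtension : (x₀ : Point) → eval x₀ lastCoeff ≢ 0ℤ → RecExtension k
  recExtension x₀ γ≢0 = record
    { d      = suc k
    ; d≥1    = s≤s z≤n
    ; c      = recCoeff k
    ; cd≢0   = x₀ , γ≢0
    ; h      = extension
    ; den≢0  = λ N → x₀ , λ γ^e≡0 →
                 γ≢0 (ℤ.i^n≡0⇒i≡0 _ (depth N) (trans (sym (eval-^ᴱ x₀ lastCoeff (depth N))) γ^e≡0))
    ; agrees = λ N x → refl
    ; rec    = λ N x → AtPoint.rec-from-homRec x N (AtPoint.homRec x N)
    }

-- Injectivity of the transfer operator

orthConst orthPrevConst : Point → ℕ → ℤ
orthConst     x j = eval x (coeff (orth j) 0)
orthPrevConst x j = eval x (coeff (orthPrev j) 0)

module _ (x : Point) (k : ℕ) (w : ℕ → ℤ) (Tw≡0 : ∀ h → h ≤ k → transfer x k w h ≡ 0ℤ) where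

  -- Tw = 0 is the three-term recurrence of the pₕ(0), started from w₀
  kernel-transfer : ∀ h → h ≤ k → w h ≡ w 0 * orthConst x h × stepDown x w h ≡ x (lv h) * (w 0 * orthPrevConst x h)
  kernel-transfer zero    _     =
    sym (ℤ.*-identityʳ (w 0)) , sym (trans (cong (x (lv 0) *_) (ℤ.*-zeroʳ (w 0))) (ℤ.*-zeroʳ (x (lv 0))))
  kernel-transfer (suc h) h<k = next , cong (x (lv (suc h)) *_) (proj₁ previous)
    where
    previous = kernel-transfer h (ℕ.<⇒≤ h<k)
    up : stepUp k w h ≡ w (suc h)
    up rewrite T⇒≡true (ℕ.<⇒<ᵇ h<k) = refl
    next : w (suc h) ≡ w 0 * orthConst x (suc h)
    next = begin
      w (suc h)
        ≡⟨ inverseˡ-unique (w (suc h)) _ (trans (cong (_+ _) (sym up)) (Tw≡0 h (ℕ.<⇒≤ h<k))) ⟩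
      - (x (bv h) * w h + stepDown x w h)
        ≡⟨ cong₂ (λ u v → - (x (bv h) * u + v)) (proj₁ previous) (proj₂ previous) ⟩
      - (x (bv h) * (w 0 * orthConst x h) + x (lv h) * (w 0 * orthPrevConst x h))
        ≡⟨ factor (x (bv h)) (x (lv h)) (w 0) (orthConst x h) (orthPrevConst x h) ⟩
      w 0 * ((- x (bv h)) * orthConst x h + (- x (lv h)) * orthPrevConst x h)
        ≡⟨ cong (w 0 *_) (coeff-orth-constant x h) ⟨
      w 0 * orthConst x (suc h) ∎
      where
      factor : ∀ b l w q r → - (b * (w * q) + l * (w * r)) ≡ w * ((- b) * q + (- l) * r)
      factor = solve-∀

  transfer-injective : orthConst x (suc k) ≢ 0ℤ → ∀ h → h ≤ k → w h ≡ 0ℤ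
  transfer-injective q≢0 h h≤k = trans (proj₁ (kernel-transfer h h≤k)) (cong (_* orthConst x h) w₀≡0)
    where
    top = kernel-transfer k ℕ.≤-refl
    up : stepUp k w k ≡ 0ℤ
    up rewrite ≤⇒<ᵇ≡false (ℕ.≤-refl {k}) = refl
    w₀q≡0 : w 0 * (- orthConst x (suc k)) ≡ 0ℤ
    w₀q≡0 = begin
      w 0 * (- orthConst x (suc k))
        ≡⟨ cong (λ q → w 0 * (- q)) (coeff-orth-constant x k) ⟩
      w 0 * (- ((- x (bv k)) * orthConst x k + (- x (lv k)) * orthPrevConst x k))
        ≡⟨ expand (w 0) (x (bv k)) (x (lv k)) (orthConst x k) (orthPrevConst x k) ⟩
      0ℤ + (x (bv k) * (w 0 * orthConst x k) + x (lv k) * (w 0 * orthPrevConst x k))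
        ≡⟨ cong₂ (λ u v → u + (x (bv k) * v + x (lv k) * (w 0 * orthPrevConst x k))) (sym up) (sym (proj₁ top)) ⟩
      stepUp k w k + (x (bv k) * w k + x (lv k) * (w 0 * orthPrevConst x k))
        ≡⟨ cong (λ v → stepUp k w k + (x (bv k) * w k + v)) (sym (proj₂ top)) ⟩
      transfer x k w k
        ≡⟨ Tw≡0 k ℕ.≤-refl ⟩
      0ℤ ∎
      where
      expand : ∀ w b l q r → w * (- ((- b) * q + (- l) * r)) ≡ 0ℤ + (b * (w * q) + l * (w * r))
      expand = solve-∀
    w₀≡0 : w 0 ≡ 0ℤ
    w₀≡0 with ℤ.i*j≡0⇒i≡0∨j≡0 (w 0) w₀q≡0
    ... | inj₁ w₀≡0 = w₀≡0
    ... | inj₂ -q≡0 = ⊥-elim (q≢0 (trans (sym (ℤ.neg-involutive _)) (cong -_ -q≡0)))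

-- The reflected point R^{(k)} at b = b^{(k)}, λ = -1

reflectedPoint : ℕ → Point
reflectedPoint k v = eval (specPoint k) (Rσ k v)

specR≡eval : ∀ k e → specR k e ≡ eval (reflectedPoint k) e
specR≡eval k = eval-substE (specPoint k) (Rσ k)

reflectedPoint-lv : ∀ k i → reflectedPoint k (lv i) ≡ -1ℤ
reflectedPoint-lv k zero    = refl
reflectedPoint-lv k (suc i) with suc i ≤ᵇ k
... | true  = refl
... | false = refl

reflectedPoint-b₀ : ∀ k → reflectedPoint k (bv 0) ≡ -1ℤ ^ k
reflectedPoint-b₀ k rewrite ≤⇒<ᵇ≡false (ℕ.≤-refl {k}) = refl

reflectedPoint-b : ∀ k {h} → 1 ≤ h → h ≤ k → reflectedPoint k (bv h) ≡ + 2 * -1ℤ ^ (k ∸ h)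
reflectedPoint-b k {h} 1≤h h≤k
  rewrite T⇒≡true (ℕ.≤⇒≤ᵇ h≤k) | T⇒≡true (ℕ.<⇒<ᵇ (ℕ.∸-monoʳ-< {k} {h} {0} 1≤h h≤k)) = refl

module _ (k : ℕ) where

  private
    y = reflectedPoint k
    q = orthConst y

  -- with b_h = 2(-1)^{k-h} and λ = -1 the recurrence pₕ₊₁(0) = -bₕ pₕ(0) + pₕ₋₁(0) collapses to a sign flip
  orthConst-step : ∀ j → j ≤ k → q (suc j) ≡ - (-1ℤ ^ (k ∸ j) * q j)
  orthConst-step zero _ = begin
    q 1                                           ≡⟨ coeff-orth-constant y 0 ⟩
    (- y (bv 0)) * 1ℤ + (- y (lv 0)) * 0ℤ        ≡⟨ cong (λ b → (- b) * 1ℤ + (- y (lv 0)) * 0ℤ) (reflectedPoint-b₀ k) ⟩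
    (- -1ℤ ^ k) * 1ℤ + (- y (lv 0)) * 0ℤ         ≡⟨ simplify (-1ℤ ^ k) (y (lv 0)) ⟩
    - (-1ℤ ^ k * 1ℤ)                              ∎
    where
    simplify : ∀ a l → (- a) * 1ℤ + (- l) * 0ℤ ≡ - (a * 1ℤ)
    simplify = solve-∀
  orthConst-step (suc j) 1+j≤k = begin
    q (suc (suc j))                               ≡⟨ coeff-orth-constant y (suc j) ⟩
    (- y (bv (suc j))) * q (suc j) + (- y (lv (suc j))) * q j
      ≡⟨ cong₂ (λ b l → (- b) * q (suc j) + (- l) * q j) (reflectedPoint-b k (s≤s z≤n) 1+j≤k) (reflectedPoint-lv k (suc j)) ⟩
    (- (+ 2 * σ)) * q (suc j) + (- -1ℤ) * q j     ≡⟨ cong (λ v → (- (+ 2 * σ)) * q (suc j) + (- -1ℤ) * v) q-prev ⟩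
    (- (+ 2 * σ)) * q (suc j) + (- -1ℤ) * (σ * q (suc j)) ≡⟨ simplify σ (q (suc j)) ⟩
    - (σ * q (suc j))                             ∎
    where
    σ = -1ℤ ^ (k ∸ suc j)
    q-here : q (suc j) ≡ σ * q j
    q-here = begin
      q (suc j)                          ≡⟨ orthConst-step j (ℕ.<⇒≤ 1+j≤k) ⟩
      - (-1ℤ ^ (k ∸ j) * q j)            ≡⟨ cong (λ n → - (-1ℤ ^ n * q j)) (∸-suc 1+j≤k) ⟩
      - ((-1ℤ * σ) * q j)                ≡⟨ flip σ (q j) ⟩
      σ * q j                            ∎
      where
      flip : ∀ s a → - ((-1ℤ * s) * a) ≡ s * a
      flip = solve-∀
    q-prev : q j ≡ σ * q (suc j)
    q-prev = begin
      q j                                ≡⟨ ℤ.*-identityˡ (q j) ⟨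
      1ℤ * q j                           ≡⟨ cong (_* q j) (-1^n*-1^n≡1 (k ∸ suc j)) ⟨
      σ * σ * q j                        ≡⟨ ℤ.*-assoc σ σ (q j) ⟩
      σ * (σ * q j)                      ≡⟨ cong (σ *_) q-here ⟨
      σ * q (suc j)                      ∎
    simplify : ∀ s a → (- (+ 2 * s)) * a + (- -1ℤ) * (s * a) ≡ - (s * a)
    simplify = solve-∀

  orthConst-square : ∀ j → j ≤ suc k → q j * q j ≡ 1ℤ
  orthConst-square zero    _         = refl
  orthConst-square (suc j) (s≤s j≤k) = begin
    q (suc j) * q (suc j)                                 ≡⟨ cong₂ _*_ (orthConst-step j j≤k) (orthConst-step j j≤k) ⟩
    (- (σ * q j)) * (- (σ * q j))                         ≡⟨ regroup σ (q j) ⟩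
    (σ * σ) * (q j * q j)                                 ≡⟨ cong₂ _*_ (-1^n*-1^n≡1 (k ∸ j)) (orthConst-square j (ℕ.m≤n⇒m≤1+n j≤k)) ⟩
    1ℤ                                                    ∎
    where
    σ = -1ℤ ^ (k ∸ j)
    regroup : ∀ s a → (- (s * a)) * (- (s * a)) ≡ (s * s) * (a * a)
    regroup = solve-∀

  orthConst≢0 : q (suc k) ≢ 0ℤ
  orthConst≢0 q≡0 with trans (sym (orthConst-square (suc k) ℕ.≤-refl)) (cong (_* q (suc k)) q≡0)
  ... | ()

  lastCoeff≢0 : eval y (Extension.lastCoeff k) ≢ 0ℤ
  lastCoeff≢0 c≡0 = orthConst≢0 (trans (sym (ℤ.neg-involutive (q (suc k)))) (cong -_ (trans (sym c≡q) c≡0)))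
    where
    c≡q : eval y (Extension.lastCoeff k) ≡ - q (suc k)
    c≡q = trans (eval--ᴱ y (coeff (orth (suc k)) (k ∸ k))) (cong (λ i → - eval y (coeff (orth (suc k)) i)) (ℕ.n∸n≡0 k))

-- Counting alternating sequences

count : ∀ {A : Set} → (A → Bool) → List A → ℤ
count p []       = 0ℤ
count p (a ∷ as) = (if p a then 1ℤ else 0ℤ) + count p as

length-filterᵇ : ∀ {A : Set} (p : A → Bool) as → + length (filterᵇ p as) ≡ count p as
length-filterᵇ p []       = refl
length-filterᵇ p (a ∷ as) with p a
... | true  = trans (ℤ.pos-+ 1 (length (filterᵇ p as))) (cong (_+_ 1ℤ) (length-filterᵇ p as))
... | false = trans (length-filterᵇ p as) (sym (ℤ.+-identityˡ _))

count-++ : ∀ {A : Set} (p : A → Bool) as bs → count p (as ++ bs) ≡ count p as + count p bs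
count-++ p []       bs = sym (ℤ.+-identityˡ _)
count-++ p (a ∷ as) bs = trans (cong (_+_ [a]) (count-++ p as bs)) (sym (ℤ.+-assoc [a] (count p as) (count p bs)))
  where
  [a] = if p a then 1ℤ else 0ℤ

count-map : ∀ {A B : Set} (p : B → Bool) (f : A → B) as → count p (map f as) ≡ count (p ∘ f) as
count-map p f []       = refl
count-map p f (a ∷ as) = cong (_+_ (if p (f a) then 1ℤ else 0ℤ)) (count-map p f as)

count-∧ : ∀ {A : Set} b (p : A → Bool) as → count (λ a → b ∧ p a) as ≡ (if b then count p as else 0ℤ)
count-∧ true  p as       = refl
count-∧ false p []       = refl
count-∧ false p (a ∷ as) = trans (ℤ.+-identityˡ _) (count-∧ false p as)

count-concatMap : ∀ {A : Set} (p : A → Bool) (g : ℕ → List A) (f : ℕ → ℕ) n →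
  count p (concatMap g (map suc (applyUpTo f n))) ≡ ∑[ i < n ] count p (g (suc (f i)))
count-concatMap p g f zero    = refl
count-concatMap p g f (suc n) = begin
  count p (g (suc (f 0)) ++ concatMap g (map suc (applyUpTo (f ∘ suc) n)))
    ≡⟨ count-++ p (g (suc (f 0))) _ ⟩
  count p (g (suc (f 0))) + count p (concatMap g (map suc (applyUpTo (f ∘ suc) n)))
    ≡⟨ cong (_+_ (count p (g (suc (f 0))))) (count-concatMap p g (f ∘ suc) n) ⟩
  count p (g (suc (f 0))) + ∑[ i < n ] count p (g (suc (f (suc i))))
    ≡⟨ ∑-splitˡ (λ i → count p (g (suc (f i)))) n ⟨
  ∑[ i < suc n ] count p (g (suc (f i))) ∎

≤ᵇ-≡ : ∀ {m n m′ n′} → (m ≤ n → m′ ≤ n′) → (m′ ≤ n′ → m ≤ n) → (m ≤ᵇ n) ≡ (m′ ≤ᵇ n′)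
≤ᵇ-≡ {m} {n} {m′} {n′} to from = ⇔→≡ {z = true} (mk⇔
  (λ m≤ᵇn → T⇒≡true (ℕ.≤⇒≤ᵇ (to   (ℕ.≤ᵇ⇒≤ m n (Equivalence.from T-≡ m≤ᵇn)))))
  (λ m≤ᵇn → T⇒≡true (ℕ.≤⇒≤ᵇ (from (ℕ.≤ᵇ⇒≤ m′ n′ (Equivalence.from T-≡ m≤ᵇn))))))

≤ᵇ≡<ᵇsuc : ∀ m n → (m ≤ᵇ n) ≡ (m <ᵇ suc n)
≤ᵇ≡<ᵇsuc zero    n = refl
≤ᵇ≡<ᵇsuc (suc m) n = refl

if-cong : ∀ {b b′} {u v : ℤ} → b ≡ b′ → u ≡ v → (if b then u else 0ℤ) ≡ (if b′ then v else 0ℤ)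
if-cong refl refl = refl

module Alternating (k : ℕ) where

  seqs : ℕ → List (List ℕ)
  seqs = allSeqs (suc k)

  ups downs : ℕ → ℕ → ℤ
  ups   n a = count (λ s → altUp   (a ∷ s)) (seqs n)
  downs n a = count (λ s → altDown (a ∷ s)) (seqs n)

  count-seqs-suc : ∀ (p : List ℕ → Bool) n → count p (seqs (suc n)) ≡ ∑[ i < suc k ] count (λ s → p (suc i ∷ s)) (seqs n)
  count-seqs-suc p n = trans (count-concatMap p (λ a → map (a ∷_) (seqs n)) (λ i → i) (suc k))
                             (∑-cong (suc k) (λ i _ → count-map p (suc i ∷_) (seqs n)))

  ups-suc : ∀ n a → ups (suc n) a ≡ ∑[ i < suc k ] (if a ≤ᵇ suc i then downs n (suc i) else 0ℤ)
  ups-suc n a = trans (count-seqs-suc (λ s → altUp (a ∷ s)) n)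
                      (∑-cong (suc k) (λ i _ → count-∧ (a ≤ᵇ suc i) (λ s → altDown (suc i ∷ s)) (seqs n)))

  downs-suc : ∀ n a → downs (suc n) a ≡ ∑[ i < suc k ] (if suc i ≤ᵇ a then ups n (suc i) else 0ℤ)
  downs-suc n a = trans (count-seqs-suc (λ s → altDown (a ∷ s)) n)
                        (∑-cong (suc k) (λ i _ → count-∧ (suc i ≤ᵇ a) (λ s → altUp (suc i ∷ s)) (seqs n)))

  reflect-index : ∀ {i} → i ≤ k → suc k ∸ (k ∸ i) ≡ suc i
  reflect-index {i} i≤k = trans (ℕ.+-∸-assoc 1 (ℕ.m∸n≤m k i)) (cong suc (ℕ.m∸[m∸n]≡n i≤k))

  -- the reflection a ↦ k + 2 - a of [1, k + 1] exchanges the two kinds of alternation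
  downs≡ups-reflected : ∀ n {j} → j ≤ k → downs n (suc j) ≡ ups n (suc k ∸ j)
  downs≡ups-reflected zero    _   = refl
  downs≡ups-reflected (suc n) {j} j≤k = sym (begin
    ups (suc n) (suc k ∸ j)
      ≡⟨ ups-suc n (suc k ∸ j) ⟩
    ∑[ i < suc k ] (if suc k ∸ j ≤ᵇ suc i then downs n (suc i) else 0ℤ)
      ≡⟨ ∑-cong (suc k) (λ i i<1+k → if-cong refl (downs≡ups-reflected n (ℕ.≤-pred i<1+k))) ⟩
    ∑[ i < suc k ] (if suc k ∸ j ≤ᵇ suc i then ups n (suc k ∸ i) else 0ℤ)
      ≡⟨ ∑-reverse (λ i → if suc k ∸ j ≤ᵇ suc i then ups n (suc k ∸ i) else 0ℤ) (suc k) ⟩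
    ∑[ i < suc k ] (if suc k ∸ j ≤ᵇ suc (k ∸ i) then ups n (suc k ∸ (k ∸ i)) else 0ℤ)
      ≡⟨ ∑-cong (suc k) (λ i i<1+k → if-cong (reflect-≤ᵇ (ℕ.≤-pred i<1+k)) (cong (ups n) (reflect-index (ℕ.≤-pred i<1+k)))) ⟩
    ∑[ i < suc k ] (if suc i ≤ᵇ suc j then ups n (suc i) else 0ℤ)
      ≡⟨ downs-suc n (suc j) ⟨
    downs (suc n) (suc j) ∎)
    where
    reflect-≤ᵇ : ∀ {i} → i ≤ k → (suc k ∸ j ≤ᵇ suc (k ∸ i)) ≡ (suc i ≤ᵇ suc j)
    reflect-≤ᵇ {i} i≤k rewrite ℕ.+-∸-assoc 1 j≤k = ≤ᵇ-≡ to from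
      where
      to : k ∸ j < suc (k ∸ i) → i < suc j
      to k∸j≤k∸i = s≤s (ℕ.≮⇒≥ (λ j<i → ℕ.<⇒≱ (ℕ.∸-monoʳ-< j<i i≤k) (ℕ.≤-pred k∸j≤k∸i)))
      from : i < suc j → k ∸ j < suc (k ∸ i)
      from (s≤s i≤j) = s≤s (ℕ.∸-monoʳ-≤ k i≤j)

  -- altCount n a: alternating sequences of length n + 1 over [1, k + 1] starting with a + 1
  altCount : ℕ → ℕ → ℤ
  altCount n a = ups n (suc a)

  altCount-suc : ∀ n {a} → a ≤ k → altCount (suc n) a ≡ ∑[ i < suc (k ∸ a) ] altCount n i
  altCount-suc n {a} a≤k = begin
    ups (suc n) (suc a)
      ≡⟨ ups-suc n (suc a) ⟩
    ∑[ i < suc k ] (if suc a ≤ᵇ suc i then downs n (suc i) else 0ℤ)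
      ≡⟨ ∑-cong (suc k) (λ i i<1+k → if-cong (sym (≤ᵇ≡<ᵇsuc a i)) (downs≡ups-reflected n (ℕ.≤-pred i<1+k))) ⟩
    ∑[ i < suc k ] (if a ≤ᵇ i then ups n (suc k ∸ i) else 0ℤ)
      ≡⟨ ∑-reverse (λ i → if a ≤ᵇ i then ups n (suc k ∸ i) else 0ℤ) (suc k) ⟩
    ∑[ i < suc k ] (if a ≤ᵇ k ∸ i then ups n (suc k ∸ (k ∸ i)) else 0ℤ)
      ≡⟨ ∑-cong (suc k) (λ i i<1+k → if-cong (reflect-≤ᵇ (ℕ.≤-pred i<1+k)) (cong (ups n) (reflect-index (ℕ.≤-pred i<1+k)))) ⟩
    ∑[ i < suc k ] (if i <ᵇ suc (k ∸ a) then altCount n i else 0ℤ)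
      ≡⟨ ∑-restrict (altCount n) (s≤s (ℕ.m∸n≤m k a)) ⟩
    ∑[ i < suc (k ∸ a) ] altCount n i ∎
    where
    reflect-≤ᵇ : ∀ {i} → i ≤ k → (a ≤ᵇ k ∸ i) ≡ (i <ᵇ suc (k ∸ a))
    reflect-≤ᵇ {i} i≤k = trans (≤ᵇ-≡ (swap i≤k) (swap a≤k)) (≤ᵇ≡<ᵇsuc i (k ∸ a))
      where
      swap : ∀ {a i} → i ≤ k → a ≤ k ∸ i → i ≤ k ∸ a
      swap {a} {i} i≤k a≤k∸i = subst (_≤ k ∸ a) (ℕ.m∸[m∸n]≡n i≤k) (ℕ.∸-monoʳ-≤ k a≤k∸i)

  #Alt≡altCount : ∀ n → + #Alt (suc k) n ≡ altCount n 0
  #Alt≡altCount zero    = refl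
  #Alt≡altCount (suc n) = trans (length-filterᵇ altUp (seqs (suc n)))
                                (trans (count-seqs-suc altUp n) (sym (altCount-suc n z≤n)))

-- The orbit of δ₀ at the reflected point, continued backwards

halve : ℕ → ℕ × Bool
halve zero = 0 , false
halve (suc h) with halve h
... | i , false = i , true
... | i , true  = suc i , false

halve-even : ∀ i → halve (i ℕ.+ i) ≡ (i , false)
halve-even zero    = refl
halve-even (suc i) rewrite ℕ.+-suc i i | halve-even i = refl

halve-odd : ∀ i → halve (suc (i ℕ.+ i)) ≡ (i , true)
halve-odd i rewrite halve-even i = refl

even-or-odd : ∀ h → Σ ℕ (λ i → h ≡ i ℕ.+ i) ⊎ Σ ℕ (λ i → h ≡ suc (i ℕ.+ i))
even-or-odd zero = inj₁ (0 , refl)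
even-or-odd (suc h) with even-or-odd h
... | inj₁ (i , h≡2i)   = inj₂ (i , cong suc h≡2i)
... | inj₂ (i , h≡2i+1) = inj₁ (suc i , trans (cong suc h≡2i+1) (cong suc (sym (ℕ.+-suc i i))))

module AltVector (k : ℕ) where

  altEntry : (ℕ → ℤ) → ℕ × Bool → ℤ
  altEntry c (i , false) = -1ℤ ^ (k ℕ.+ i) * (c (k ∸ i) - c i)
  altEntry c (i , true)  = -1ℤ ^ i * (c (k ∸ i) - c (suc i))

  -- (-1)^{kr} altVector (altCount r) is the state of the orbit of δ₀ at time -r
  altVector : (ℕ → ℤ) → ℕ → ℤ
  altVector c zero    = c 0
  altVector c (suc h) = altEntry c (halve h)

  altVector-odd : ∀ c i → altVector c (suc (i ℕ.+ i)) ≡ -1ℤ ^ (k ℕ.+ i) * (c (k ∸ i) - c i)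
  altVector-odd c i = cong (altEntry c) (halve-even i)

  altVector-even : ∀ c i → altVector c (suc (suc (i ℕ.+ i))) ≡ -1ℤ ^ i * (c (k ∸ i) - c (suc i))
  altVector-even c i = cong (altEntry c) (halve-odd i)

  altVector-const : ∀ h → altVector (λ _ → 1ℤ) h ≡ δ h 0
  altVector-const zero = refl
  altVector-const (suc h) with halve h
  ... | i , false = ℤ.*-zeroʳ (-1ℤ ^ (k ℕ.+ i))
  ... | i , true  = ℤ.*-zeroʳ (-1ℤ ^ i)

  module _ (1≤k : 1 ≤ k) (c c′ : ℕ → ℤ) (c′≡∑c : ∀ a → a ≤ k → c′ a ≡ ∑< (suc (k ∸ a)) c) where

    private
      y = reflectedPoint k
      σ = -1ℤ ^ k
      P : ℕ → ℤ
      P m = ∑< m c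
      V′ = altVector c′

    c′-reflected : ∀ {j} → j ≤ k → c′ (k ∸ j) ≡ P (suc j)
    c′-reflected {j} j≤k = trans (c′≡∑c (k ∸ j) (ℕ.m∸n≤m k j)) (cong (P ∘ suc) (ℕ.m∸[m∸n]≡n j≤k))

    c≡ΔP : ∀ a → c a ≡ P (suc a) - P a
    c≡ΔP a = difference (P a) (c a)
      where
      difference : ∀ p q → q ≡ p + q - p
      difference = solve-∀

    transfer-altVector-0 : transfer y k V′ 0 ≡ σ * altVector c 0
    transfer-altVector-0 = begin
      stepUp k V′ 0 + (y (bv 0) * c′ 0 + 0ℤ)
        ≡⟨ cong₂ (λ u b → u + (b * c′ 0 + 0ℤ)) up (reflectedPoint-b₀ k) ⟩
      -1ℤ ^ (k ℕ.+ 0) * (c′ k - c′ 0) + (σ * c′ 0 + 0ℤ)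
        ≡⟨ cong₂ (λ e v → -1ℤ ^ e * (v - c′ 0) + (σ * c′ 0 + 0ℤ)) (ℕ.+-identityʳ k) (c′-reflected z≤n) ⟩
      σ * (0ℤ + c 0 - c′ 0) + (σ * c′ 0 + 0ℤ)
        ≡⟨ simplify σ (c 0) (c′ 0) ⟩
      σ * c 0 ∎
      where
      up : stepUp k V′ 0 ≡ V′ 1
      up rewrite T⇒≡true (ℕ.<⇒<ᵇ 1≤k) = refl
      simplify : ∀ s a b → s * (0ℤ + a - b) + (s * b + 0ℤ) ≡ s * a
      simplify = solve-∀

    V′-even : ∀ i → suc (i ℕ.+ i) ≤ k → V′ (i ℕ.+ i) ≡ - (-1ℤ ^ i * (P i - P (suc (k ∸ i))))
    V′-even zero    _ = trans (c′≡∑c 0 z≤n) (flip (P (suc k)))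
      where
      flip : ∀ p → p ≡ - (1ℤ * (0ℤ + 0ℤ - p))
      flip = solve-∀
    V′-even (suc i) 2i+3≤k = begin
      V′ (suc i ℕ.+ suc i)                           ≡⟨ cong V′ (cong suc (ℕ.+-suc i i)) ⟩
      V′ (suc (suc (i ℕ.+ i)))                       ≡⟨ altVector-even c′ i ⟩
      -1ℤ ^ i * (c′ (k ∸ i) - c′ (suc i))            ≡⟨ cong₂ (λ u v → -1ℤ ^ i * (u - v)) (c′-reflected (ℕ.<⇒≤ i<k)) (c′≡∑c (suc i) i<k) ⟩
      -1ℤ ^ i * (P (suc i) - P (suc (k ∸ suc i)))    ≡⟨ flip (-1ℤ ^ i) (P (suc i)) (P (suc (k ∸ suc i))) ⟩
      - (-1ℤ ^ suc i * (P (suc i) - P (suc (k ∸ suc i)))) ∎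
      where
      i<k : suc i ≤ k
      i<k = ℕ.≤-trans (s≤s (ℕ.m≤m+n i (suc i))) (ℕ.<⇒≤ 2i+3≤k)
      flip : ∀ s p q → s * (p - q) ≡ - ((-1ℤ * s) * (p - q))
      flip = solve-∀

    V′-odd : ∀ i → i ≤ k → V′ (suc (i ℕ.+ i)) ≡ (σ * -1ℤ ^ i) * (P (suc i) - P (suc (k ∸ i)))
    V′-odd i i≤k = trans (altVector-odd c′ i)
      (cong₂ _*_ (ℤ.^-distribˡ-+-* -1ℤ k i) (cong₂ _-_ (c′-reflected i≤k) (c′≡∑c i i≤k)))

    c′-step : ∀ {i} → suc i ≤ k → c′ (suc i) ≡ P (k ∸ i)
    c′-step {i} i<k = trans (c′≡∑c (suc i) i<k) (cong P (sym (∸-suc i<k)))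

    top : ∀ {h} → h ≤ k → (h <ᵇ k) ≡ false → k ≡ h
    top h≤k h≮ᵇk = ℕ.≤-antisym (<ᵇ≡false⇒≥ h≮ᵇk) h≤k

    transfer-altVector-odd : ∀ i → suc (i ℕ.+ i) ≤ k →
      transfer y k V′ (suc (i ℕ.+ i)) ≡ σ * altVector c (suc (i ℕ.+ i))
    transfer-altVector-odd i h≤k = begin
      stepUp k V′ h + (y (bv h) * V′ h + stepDown y V′ h)
        ≡⟨ cong₂ _+_ up (cong₂ _+_ (cong₂ _*_ b (V′-odd i (ℕ.<⇒≤ i<k))) down) ⟩
      s * (A₁ - B₀) + ((+ 2 * (σ * (-1ℤ * 1ℤ))) * ((σ * s) * (A₁ - B₁)) + -1ℤ * (- (s * (A₀ - B₁))))
        ≡⟨ mod-square≡1 {σ} (-1^n*-1^n≡1 k) (s * (A₁ - B₀ + A₀ - B₁)) (identity σ s A₁ B₀ B₁ A₀) ⟩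
      σ * ((σ * s) * ((B₁ - B₀) - (A₁ - A₀)))
        ≡⟨ cong (σ *_) target ⟨
      σ * altVector c h ∎
      where
      h = suc (i ℕ.+ i)
      s = -1ℤ ^ i
      A₁ = P (suc i)
      B₀ = P (k ∸ i)
      B₁ = P (suc (k ∸ i))
      A₀ = P i
      i<k : suc i ≤ k
      i<k = ℕ.≤-trans (s≤s (ℕ.m≤m+n i i)) h≤k
      up : stepUp k V′ h ≡ s * (A₁ - B₀)
      up with h <ᵇ k in h<ᵇk
      ... | true = trans (altVector-even c′ i) (cong₂ (λ u v → s * (u - v)) (c′-reflected (ℕ.<⇒≤ i<k)) (c′-step i<k))
      ... | false = sym (trans (cong (λ n → s * (A₁ - P n)) k∸i≡1+i) (trans (cong (s *_) (ℤ.+-inverseʳ A₁)) (ℤ.*-zeroʳ s)))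
        where
        k∸i≡1+i : k ∸ i ≡ suc i
        k∸i≡1+i = trans (cong (_∸ i) (top h≤k h<ᵇk)) (trans (cong (_∸ i) (sym (ℕ.+-suc i i))) (ℕ.m+n∸m≡n i (suc i)))
      b : y (bv h) ≡ + 2 * (σ * (-1ℤ * 1ℤ))
      b = trans (reflectedPoint-b k (s≤s z≤n) h≤k)
                (cong (+ 2 *_) (trans (-1^[m∸n] h≤k) (cong (λ t → σ * (-1ℤ * t)) (-1^[n+n]≡1 i))))
      down : stepDown y V′ h ≡ -1ℤ * (- (s * (A₀ - B₁)))
      down = cong₂ _*_ (reflectedPoint-lv k h) (V′-even i h≤k)
      target : altVector c h ≡ (σ * s) * ((B₁ - B₀) - (A₁ - A₀))
      target = trans (altVector-odd c i) (cong₂ _*_ (ℤ.^-distribˡ-+-* -1ℤ k i) (cong₂ _-_ (c≡ΔP (k ∸ i)) (c≡ΔP i)))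
      identity : ∀ σ s A₁ B₀ B₁ A₀ →
        s * (A₁ - B₀) + ((+ 2 * (σ * (-1ℤ * 1ℤ))) * ((σ * s) * (A₁ - B₁)) + -1ℤ * (- (s * (A₀ - B₁))))
          ≡ σ * ((σ * s) * ((B₁ - B₀) - (A₁ - A₀))) + (1ℤ - σ * σ) * (s * (A₁ - B₀ + A₀ - B₁))
      identity = solve-∀

    transfer-altVector-even : ∀ i → suc (suc (i ℕ.+ i)) ≤ k →
      transfer y k V′ (suc (suc (i ℕ.+ i))) ≡ σ * altVector c (suc (suc (i ℕ.+ i)))
    transfer-altVector-even i h≤k = begin
      stepUp k V′ h + (y (bv h) * V′ h + stepDown y V′ h)
        ≡⟨ cong₂ _+_ up (cong₂ _+_ (cong₂ _*_ b here) down) ⟩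
      (σ * (-1ℤ * s)) * (A₂ - B₀) + ((+ 2 * (σ * (-1ℤ * (-1ℤ * 1ℤ)))) * (s * (A₁ - B₀)) + -1ℤ * ((σ * s) * (A₁ - B₁)))
        ≡⟨ identity σ s A₁ A₂ B₀ B₁ ⟩
      σ * (s * ((B₁ - B₀) - (A₂ - A₁)))
        ≡⟨ cong (σ *_) target ⟨
      σ * altVector c h ∎
      where
      h = suc (suc (i ℕ.+ i))
      s = -1ℤ ^ i
      A₁  = P (suc i)
      A₂ = P (suc (suc i))
      B₀  = P (k ∸ i)
      B₁  = P (suc (k ∸ i))
      i<k : suc i ≤ k
      i<k = ℕ.≤-trans (s≤s (ℕ.≤-trans (ℕ.m≤m+n i i) (ℕ.n≤1+n (i ℕ.+ i)))) h≤k
      up : stepUp k V′ h ≡ (σ * (-1ℤ * s)) * (A₂ - B₀)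
      up with h <ᵇ k in h<ᵇk
      ... | true = begin
        V′ (suc (suc (suc (i ℕ.+ i))))                      ≡⟨ cong (V′ ∘ suc ∘ suc) (ℕ.+-suc i i) ⟨
        V′ (suc (suc i ℕ.+ suc i))                          ≡⟨ altVector-odd c′ (suc i) ⟩
        -1ℤ ^ (k ℕ.+ suc i) * (c′ (k ∸ suc i) - c′ (suc i)) ≡⟨ cong₂ _*_ (ℤ.^-distribˡ-+-* -1ℤ k (suc i))
                                                                         (cong₂ _-_ (c′-reflected i<k) (c′-step i<k)) ⟩
        (σ * (-1ℤ * s)) * (A₂ - B₀)                          ∎
      ... | false = sym (trans (cong (λ n → (σ * (-1ℤ * s)) * (A₂ - P n)) k∸i≡2+i)
                               (trans (cong ((σ * (-1ℤ * s)) *_) (ℤ.+-inverseʳ A₂)) (ℤ.*-zeroʳ (σ * (-1ℤ * s)))))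
        where
        k∸i≡2+i : k ∸ i ≡ suc (suc i)
        k∸i≡2+i = trans (cong (_∸ i) (top h≤k h<ᵇk))
                        (trans (cong (_∸ i) (sym (trans (ℕ.+-suc i (suc i)) (cong suc (ℕ.+-suc i i))))) (ℕ.m+n∸m≡n i (suc (suc i))))
      b : y (bv h) ≡ + 2 * (σ * (-1ℤ * (-1ℤ * 1ℤ)))
      b = trans (reflectedPoint-b k (s≤s z≤n) h≤k)
                (cong (+ 2 *_) (trans (-1^[m∸n] h≤k) (cong (λ t → σ * (-1ℤ * (-1ℤ * t))) (-1^[n+n]≡1 i))))
      here : V′ h ≡ s * (A₁ - B₀)
      here = trans (altVector-even c′ i) (cong₂ (λ u v → s * (u - v)) (c′-reflected (ℕ.<⇒≤ i<k)) (c′-step i<k))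
      down : stepDown y V′ h ≡ -1ℤ * ((σ * s) * (A₁ - B₁))
      down = cong₂ _*_ (reflectedPoint-lv k h) (V′-odd i (ℕ.<⇒≤ i<k))
      target : altVector c h ≡ s * ((B₁ - B₀) - (A₂ - A₁))
      target = trans (altVector-even c i) (cong (s *_) (cong₂ _-_ (c≡ΔP (k ∸ i)) (c≡ΔP (suc i))))
      identity : ∀ σ s A₁ A₂ B₀ B₁ →
        (σ * (-1ℤ * s)) * (A₂ - B₀) + ((+ 2 * (σ * (-1ℤ * (-1ℤ * 1ℤ)))) * (s * (A₁ - B₀)) + -1ℤ * ((σ * s) * (A₁ - B₁)))
          ≡ σ * (s * ((B₁ - B₀) - (A₂ - A₁)))
      identity = solve-∀

    transfer-altVector : ∀ h → h ≤ k → transfer y k V′ h ≡ σ * altVector c h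
    transfer-altVector zero    _ = transfer-altVector-0
    transfer-altVector (suc h) h<k with even-or-odd h
    ... | inj₁ (i , refl) = transfer-altVector-odd i h<k
    ... | inj₂ (i , refl) = transfer-altVector-even i h<k

module BackwardOrbit (k : ℕ) (1≤k : 1 ≤ k) where

  open Alternating k using (altCount; altCount-suc; #Alt≡altCount)
  open AltVector k using (altVector; altVector-const; transfer-altVector)
  open Extension k using (lastCoeff; window; backStep; windowSum; numerator; extension; window-top)

  private
    y = reflectedPoint k
    σ = -1ℤ ^ k
    p = orth (suc k)

  pastState : ℕ → ℕ → ℤ
  pastState r h = -1ℤ ^ (k ℕ.* r) * altVector (altCount r) h

  pastState-zero : ∀ h → pastState 0 h ≡ pathSum y k 0 h
  pastState-zero h = begin
    -1ℤ ^ (k ℕ.* 0) * altVector (altCount 0) h   ≡⟨ cong (λ e → -1ℤ ^ e * altVector (altCount 0) h) (ℕ.*-zeroʳ k) ⟩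
    1ℤ * altVector (altCount 0) h                 ≡⟨ ℤ.*-identityˡ _ ⟩
    altVector (λ _ → 1ℤ) h                        ≡⟨ altVector-const h ⟩
    δ h 0                                         ≡⟨ pathSum-zero y k h ⟨
    pathSum y k 0 h                               ∎

  transfer-pastState : ∀ r h → h ≤ k → transfer y k (pastState (suc r)) h ≡ pastState r h
  transfer-pastState r h h≤k = begin
    transfer y k (pastState (suc r)) h
      ≡⟨ transfer-scale y k (-1ℤ ^ (k ℕ.* suc r)) (altVector (altCount (suc r))) h h≤k ⟩
    -1ℤ ^ (k ℕ.* suc r) * transfer y k (altVector (altCount (suc r))) h
      ≡⟨ cong₂ _*_ (trans (cong (-1ℤ ^_) (ℕ.*-suc k r)) (ℤ.^-distribˡ-+-* -1ℤ k (k ℕ.* r)))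
                   (transfer-altVector 1≤k (altCount r) (altCount (suc r)) (λ a → altCount-suc r) h h≤k) ⟩
    σ * -1ℤ ^ (k ℕ.* r) * (σ * altVector (altCount r) h)
      ≡⟨ regroup σ (-1ℤ ^ (k ℕ.* r)) (altVector (altCount r) h) ⟩
    σ * σ * pastState r h
      ≡⟨ cong (_* pastState r h) (-1^n*-1^n≡1 k) ⟩
    1ℤ * pastState r h
      ≡⟨ ℤ.*-identityˡ _ ⟩
    pastState r h ∎
    where
    regroup : ∀ s t v → s * t * (s * v) ≡ s * s * (t * v)
    regroup = solve-∀

  -- orbitFrom m n is the state at time n - m
  orbitFrom : ℕ → ℕ → ℕ → ℤ
  orbitFrom zero    n       = pathSum y k n
  orbitFrom (suc m) zero    = pastState (suc m)
  orbitFrom (suc m) (suc n) = orbitFrom m n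

  orbitFrom-isOrbit : ∀ m → IsOrbit y k (orbitFrom m)
  orbitFrom-isOrbit zero          n       h h≤k = pathSum-suc y k n h
  orbitFrom-isOrbit (suc zero)    zero    h h≤k = sym (trans (transfer-pastState 0 h h≤k) (pastState-zero h))
  orbitFrom-isOrbit (suc (suc m)) zero    h h≤k = sym (transfer-pastState (suc m) h h≤k)
  orbitFrom-isOrbit (suc m)       (suc n) h h≤k = orbitFrom-isOrbit m n h h≤k

  orbitFrom-shift : ∀ c m n h → orbitFrom (c ℕ.+ m) (c ℕ.+ n) h ≡ orbitFrom m n h
  orbitFrom-shift zero    m n h = refl
  orbitFrom-shift (suc c) m n h = orbitFrom-shift c m n h

  orbitFrom-forward : ∀ {m n} h → m ≤ n → orbitFrom m n h ≡ pathSum y k (n ∸ m) h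
  orbitFrom-forward h z≤n       = refl
  orbitFrom-forward h (s≤s m≤n) = orbitFrom-forward h m≤n

  annihilated-forward : ∀ m i h → h ≤ k → polyOrbit y p (orbitFrom m) (m ℕ.+ i) h ≡ 0ℤ
  annihilated-forward m i h h≤k = trans
    (polyAct-shift y p (λ n → orbitFrom m n h) (λ n → pathSum y k n h) (m ℕ.+ i) i
      (λ t → trans (cong (λ n → orbitFrom n (m ℕ.+ i ℕ.+ t) h) (sym (ℕ.+-identityʳ m)))
                   (trans (cong (λ n → orbitFrom (m ℕ.+ 0) n h) (ℕ.+-assoc m i t)) (orbitFrom-shift m 0 (i ℕ.+ t) h))))
    (orth-annihilates y k (pathSum y k) (λ n h _ → pathSum-suc y k n h) (λ h _ → pathSum-zero y k h) i h h≤k)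

  -- p(T) commutes with T, which is injective at y
  annihilated-backward : ∀ m j → j ≤ m → ∀ h → h ≤ k → polyOrbit y p (orbitFrom m) (m ∸ j) h ≡ 0ℤ
  annihilated-backward m zero    _   h h≤k = trans (cong (λ n → polyOrbit y p (orbitFrom m) n h) (sym (ℕ.+-identityʳ m)))
                                                   (annihilated-forward m 0 h h≤k)
  annihilated-backward m (suc j) j<m h h≤k = transfer-injective y k (λ h → polyOrbit y p (orbitFrom m) (m ∸ suc j) h)
    image≡0 (orthConst≢0 k) h h≤k
    where
    image≡0 : ∀ h → h ≤ k → transfer y k (λ h → polyOrbit y p (orbitFrom m) (m ∸ suc j) h) h ≡ 0ℤ
    image≡0 h h≤k = begin
      transfer y k (λ h → polyOrbit y p (orbitFrom m) (m ∸ suc j) h) h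
        ≡⟨ polyOrbit-isOrbit y k p (orbitFrom m) (orbitFrom-isOrbit m) (m ∸ suc j) h h≤k ⟨
      polyOrbit y p (orbitFrom m) (suc (m ∸ suc j)) h
        ≡⟨ cong (λ n → polyOrbit y p (orbitFrom m) n h) (∸-suc j<m) ⟨
      polyOrbit y p (orbitFrom m) (m ∸ j) h
        ≡⟨ annihilated-backward m j (ℕ.<⇒≤ j<m) h h≤k ⟩
      0ℤ ∎

  orbitFrom-recurrence : ∀ m → orbitFrom m (suc k) 0 ≡ recurrenceSum y k (λ n → orbitFrom m n 0) (suc k)
  orbitFrom-recurrence m = recurrence-if-annihilated y k (λ n → orbitFrom m n 0) 0
    (trans (cong (λ n → polyOrbit y p (orbitFrom m) n 0) (sym (ℕ.n∸n≡0 m))) (annihilated-backward m m ℕ.≤-refl 0 z≤n))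

  private
    γ = eval y lastCoeff

  windowRecSum : ℕ → ℕ → ℤ
  windowRecSum m i = ∑[ t < i ] (eval y (recCoeff k (suc t)) * orbitFrom (m ℕ.+ suc t) k 0)

  recurrenceSum≡windowRecSum : ∀ m → recurrenceSum y k (λ n → orbitFrom (suc m) n 0) (suc k) ≡ windowRecSum m (suc k)
  recurrenceSum≡windowRecSum m =
    ∑-cong (suc k) (λ t t<1+k → cong (eval y (recCoeff k (suc t)) *_) (sym (shifted (ℕ.≤-pred t<1+k))))
    where
    shifted : ∀ {t} → t ≤ k → orbitFrom (m ℕ.+ suc t) k 0 ≡ orbitFrom (suc m) (k ∸ t) 0
    shifted {t} t≤k = trans (cong₂ (λ a b → orbitFrom a b 0) (trans (ℕ.+-comm m (suc t)) (sym (ℕ.+-suc t m)))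
                                                                (sym (ℕ.m+[n∸m]≡n t≤k)))
                            (orbitFrom-shift t (suc m) (k ∸ t) 0)

  windowSum-reflected : ∀ m → (∀ t → t ≤ k → eval y (window m t) ≡ γ ^ m * orbitFrom (m ℕ.+ t) k 0) →
    ∀ i → i ≤ k → eval y (windowSum m i) ≡ γ ^ m * windowRecSum m i
  windowSum-reflected m windows zero    _   = sym (ℤ.*-zeroʳ (γ ^ m))
  windowSum-reflected m windows (suc i) i<k = begin
    eval y (windowSum m i) + c * eval y (window m (suc i))
      ≡⟨ cong₂ (λ u v → u + c * v) (windowSum-reflected m windows i (ℕ.<⇒≤ i<k)) (windows (suc i) i<k) ⟩
    γ ^ m * windowRecSum m i + c * (γ ^ m * orbitFrom (m ℕ.+ suc i) k 0)
      ≡⟨ factor (γ ^ m) (windowRecSum m i) c (orbitFrom (m ℕ.+ suc i) k 0) ⟩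
    γ ^ m * windowRecSum m (suc i) ∎
    where
    c = eval y (recCoeff k (suc i))
    factor : ∀ g r c o → g * r + c * (g * o) ≡ g * (r + c * o)
    factor = solve-∀

  window-reflected : ∀ m j → j ≤ k → eval y (window m j) ≡ γ ^ m * orbitFrom (m ℕ.+ j) k 0
  window-reflected zero j j≤k = trans (sym (orbitFrom-forward 0 j≤k)) (sym (ℤ.*-identityˡ _))
  window-reflected (suc m) j j≤k with j <ᵇ k in j<ᵇk
  ... | true = begin
    γ * eval y (window m (suc j))                  ≡⟨ cong (γ *_) (window-reflected m (suc j) (<ᵇ≡true⇒< j<ᵇk)) ⟩
    γ * (γ ^ m * orbitFrom (m ℕ.+ suc j) k 0)      ≡⟨ ℤ.*-assoc γ (γ ^ m) _ ⟨
    γ ^ suc m * orbitFrom (m ℕ.+ suc j) k 0        ≡⟨ cong (λ n → γ ^ suc m * orbitFrom n k 0) (ℕ.+-suc m j) ⟩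
    γ ^ suc m * orbitFrom (suc m ℕ.+ j) k 0        ∎
  ... | false with ℕ.≤-antisym j≤k (<ᵇ≡false⇒≥ j<ᵇk)
  ... | refl = begin
    eval y (window m 0) + eval y (-ᴱ windowSum m k)
      ≡⟨ cong₂ _+_ (window-reflected m 0 z≤n)
                   (trans (eval--ᴱ y (windowSum m k)) (cong -_ (windowSum-reflected m (window-reflected m) k ℕ.≤-refl))) ⟩
    γ ^ m * orbitFrom (m ℕ.+ 0) k 0 + - (γ ^ m * windowRecSum m k)
      ≡⟨ cong (λ o → γ ^ m * o + - (γ ^ m * windowRecSum m k)) recurrence ⟩
    γ ^ m * (windowRecSum m k + γ * orbitFrom (m ℕ.+ suc k) k 0) + - (γ ^ m * windowRecSum m k)
      ≡⟨ cancel (γ ^ m) (windowRecSum m k) γ (orbitFrom (m ℕ.+ suc k) k 0) ⟩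
    γ * γ ^ m * orbitFrom (m ℕ.+ suc k) k 0
      ≡⟨ cong (λ n → γ * γ ^ m * orbitFrom n k 0) (ℕ.+-suc m k) ⟩
    γ ^ suc m * orbitFrom (suc m ℕ.+ k) k 0 ∎
    where
    recurrence : orbitFrom (m ℕ.+ 0) k 0 ≡ windowRecSum m (suc k)
    recurrence = trans (cong (λ n → orbitFrom n k 0) (ℕ.+-identityʳ m))
                       (trans (orbitFrom-recurrence (suc m)) (recurrenceSum≡windowRecSum m))
    cancel : ∀ g r c o → g * (r + c * o) + - (g * r) ≡ c * g * o
    cancel = solve-∀

  numerator-reflected : ∀ m → eval y (numerator -[1+ m ]) ≡ γ ^ suc m * (-1ℤ ^ (k ℕ.* suc m) * + #Alt (suc k) (suc m))
  numerator-reflected m = begin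
    eval y (backStep m)                                   ≡⟨ cong (eval y) (window-top m) ⟨
    eval y (window (suc m) k)                             ≡⟨ window-reflected (suc m) k ℕ.≤-refl ⟩
    γ ^ suc m * orbitFrom (suc m ℕ.+ k) k 0
      ≡⟨ cong₂ (λ a b → γ ^ suc m * orbitFrom a b 0) (ℕ.+-comm (suc m) k) (sym (ℕ.+-identityʳ k)) ⟩
    γ ^ suc m * orbitFrom (k ℕ.+ suc m) (k ℕ.+ 0) 0      ≡⟨ cong (γ ^ suc m *_) (orbitFrom-shift k (suc m) 0 0) ⟩
    γ ^ suc m * pastState (suc m) 0                       ≡⟨ cong (λ a → γ ^ suc m * (-1ℤ ^ (k ℕ.* suc m) * a)) (#Alt≡altCount (suc m)) ⟨
    γ ^ suc m * (-1ℤ ^ (k ℕ.* suc m) * + #Alt (suc k) (suc m)) ∎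

  extension-reflected : ∀ n → specR k (den (extension (- + n))) ≢ 0ℤ
    × -1ℤ ^ (k ℕ.* n) * specR k (num (extension (- + n))) ≡ + #Alt (suc k) n * specR k (den (extension (- + n)))
  extension-reflected zero    = (λ ()) , cong (λ e → -1ℤ ^ e * 1ℤ) (ℕ.*-zeroʳ k)
  extension-reflected (suc m) = γ^[1+m]≢0 ∘ trans (sym denominator) , (begin
    σₘ * specR k (numerator -[1+ m ])         ≡⟨ cong (σₘ *_) (trans (specR≡eval k (numerator -[1+ m ])) (numerator-reflected m)) ⟩
    σₘ * (γ ^ suc m * (σₘ * a))               ≡⟨ regroup σₘ (γ ^ suc m) a ⟩
    σₘ * σₘ * (a * γ ^ suc m)                 ≡⟨ cong (_* (a * γ ^ suc m)) (-1^n*-1^n≡1 (k ℕ.* suc m)) ⟩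
    1ℤ * (a * γ ^ suc m)                      ≡⟨ ℤ.*-identityˡ _ ⟩
    a * γ ^ suc m                             ≡⟨ cong (a *_) denominator ⟨
    a * specR k (lastCoeff ^ᴱ suc m)          ∎)
    where
    σₘ = -1ℤ ^ (k ℕ.* suc m)
    a  = + #Alt (suc k) (suc m)
    denominator : specR k (lastCoeff ^ᴱ suc m) ≡ γ ^ suc m
    denominator = trans (specR≡eval k (lastCoeff ^ᴱ suc m)) (eval-^ᴱ y lastCoeff (suc m))
    γ^[1+m]≢0 : γ ^ suc m ≢ 0ℤ
    γ^[1+m]≢0 γ^[1+m]≡0 = lastCoeff≢0 k (ℤ.i^n≡0⇒i≡0 γ (suc m) γ^[1+m]≡0)
    regroup : ∀ s g a → s * (g * (s * a)) ≡ s * s * (a * g)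
    regroup = solve-∀

lemma7p4 : (n k : ℕ) → 1 ≤ k →
    Σ (RecExtension k) (λ E →
      specR k (den (RecExtension.h E (- (+ n)))) ≢ + 0
      × (- (+ 1)) ^ (k Data.Nat.* n) * specR k (num (RecExtension.h E (- (+ n))))
          ≡ + (#Alt (suc k) n) * specR k (den (RecExtension.h E (- (+ n)))))
lemma7p4 n k 1≤k = Extension.recExtension k (reflectedPoint k) (lastCoeff≢0 k) , BackwardOrbit.extension-reflected k 1≤k n
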